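{- Let $R=D\times[0,2]$ be a duplex region and let $s$ be a sock in $G(R)$. Then $s$ is flip and trit homotopic in $G(R)$ to the empty sock.
   Context: $D$ is a connected, simply connected finite union of unit squares $[x,x+1]\times[y,y+1]$ ($x,y\in\mathbb{Z}$). $G(R)$ is the subgraph of the grid graph $\mathbb{Z}^2$ whose vertices are the $(x,y)$ with $[x,x+1]\times[y,y+1]\subset D$, two vertices adjacent iff at distance 1. A sock in $G(R)$ is a finite set of pairwise vertex-disjoint directed simple cycles in $G(R)$; a jewel is a vertex of $G(R)$ on no cycle. The empty sock has no cycles. Moves in $G(R)$ (all vertices involved must be vertices of $G(R)$): flip moves: (a) if $u\to v$ is a sock edge and $u',v'$ are jewels with $u,v,v',u'$ the vertices of a unit square ($u'$ adjacent to $u$, $v'$ to $v$), replace $u\to v$ by $u\to u'\to v'\to v$, or the reverse; (b) if $u\to v$ and $w\to x$ are sock edges forming opposite sides of a unit square with $u$ adjacent to $x$ and $v$ adjacent to $w$, replace them by $u\to x$ and $w\to v$; (c) if the four vertices of a unit square are jewels, add its boundary as a cycle with either orientation, or conversely remove a cycle of length 4. Trit move: if $u\to v\to w$ are consecutive edges of a cycle of the sock with $u,v,w$ three vertices of a unit square whose fourth vertex $j$ is a jewel, replace $u\to v\to w$ by $u\to j\to w$ (so $v$ becomes a jewel). Two socks are flip and trit homotopic in $G(R)$ if related by a finite sequence of flip and trit moves in $G(R)$. -}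

module Defs where

open import Data.Integer using (ℤ; ∣_∣; _-_; _<_)
open import Data.Nat using (ℕ; _+_; _≤_)
open import Data.Product using (_×_; _,_; ∃; proj₁)
open import Data.Sum using (_⊎_)
open import Data.List using (List; []; _∷_)
open import Data.List.Membership.Propositional using (_∈_; _∉_)
open import Relation.Binary.PropositionalEquality using (_≡_; _≢_)
open import Relation.Binary.Construct.Closure.ReflexiveTransitive using (Star)
open import Relation.Nullary using (¬_)
open import Function.Bundles using (_⇔_)

-- Cells / vertices.  A cell (x , y) stands for the unit square
-- [x,x+1] × [y,y+1]; it is also the vertex (x , y) of the grid graph Z².

V : Set
V = ℤ × ℤ

Region : Set
Region = List V

Adj : V → V → Set
Adj (x₁ , y₁) (x₂ , y₂) = ∣ x₁ - x₂ ∣ + ∣ y₁ - y₂ ∣ ≡ 1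

Touch : V → V → Set
Touch (x₁ , y₁) (x₂ , y₂) =
  (x₁ , y₁) ≢ (x₂ , y₂) × ∣ x₁ - x₂ ∣ ≤ 1 × ∣ y₁ - y₂ ∣ ≤ 1

-- The union of the squares of D is connected (squares meeting at a corner
-- are connected through that corner).
Connected : Region → Set
Connected D = ∀ {a b} → a ∈ D → b ∈ D →
  Star (λ c d → c ∈ D × d ∈ D × Touch c d) a b

-- The union of the squares of D (a compact planar polyhedron, connected) is
-- simply connected iff its complement in R² is connected, i.e. iff every cell
-- outside D is joined by an edge-adjacent path of cells outside D to a cell
-- lying strictly to the right of all of D (the unbounded component).
ComplementConnected : Region → Set
ComplementConnected D = ∀ c → c ∉ D →
  ∃ λ c' → (∀ d → d ∈ D → proj₁ d < proj₁ c') ×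
           Star (λ a b → a ∉ D × b ∉ D × Adj a b) c c'

SimplyConnected : Region → Set
SimplyConnected D = Connected D × ComplementConnected D

-- Socks in G(R), where the vertices of G(R) are the cells of D.
-- A sock (finite set of pairwise vertex-disjoint directed simple cycles)
-- is represented by its finite set of directed edges.

Edge : Set
Edge = V × V

Sock : Set
Sock = List Edge

record IsSock (D : Region) (s : Sock) : Set where
  field
    edges   : ∀ {u v} → (u , v) ∈ s → u ∈ D × v ∈ D × Adj u v
    outUniq : ∀ {u v v'} → (u , v) ∈ s → (u , v') ∈ s → v ≡ v'
    inUniq  : ∀ {u u' v} → (u , v) ∈ s → (u' , v) ∈ s → u ≡ u'
    next    : ∀ {u v} → (u , v) ∈ s → ∃ λ w → (v , w) ∈ s
    prev    : ∀ {u v} → (u , v) ∈ s → ∃ λ w → (w , u) ∈ s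
    noBack  : ∀ {u v} → (u , v) ∈ s → (v , u) ∉ s

OnSock : Sock → V → Set
OnSock s v = ∃ λ w → (v , w) ∈ s ⊎ (w , v) ∈ s

Jewel : Region → Sock → V → Set
Jewel D s v = v ∈ D × ¬ OnSock s v

Square : V → V → V → V → Set
Square a b c d = Adj a b × Adj b c × Adj c d × Adj d a × a ≢ c × b ≢ d

Replace : Sock → List Edge → List Edge → Sock → Set
Replace s rem add t = ∀ e → (e ∈ t) ⇔ ((e ∈ s × e ∉ rem) ⊎ e ∈ add)

data Fwd (D : Region) (s t : Sock) : Set where
  flipA : ∀ {u v u' v'} → (u , v) ∈ s → Jewel D s u' → Jewel D s v' →
          Square u v v' u' →
          Replace s ((u , v) ∷ []) ((u , u') ∷ (u' , v') ∷ (v' , v) ∷ []) t →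
          Fwd D s t
  flipB : ∀ {u v w x} → (u , v) ∈ s → (w , x) ∈ s → Square u v w x →
          Replace s ((u , v) ∷ (w , x) ∷ []) ((u , x) ∷ (w , v) ∷ []) t →
          Fwd D s t
  flipC : ∀ {a b c d} → Jewel D s a → Jewel D s b → Jewel D s c → Jewel D s d →
          Square a b c d →
          Replace s [] ((a , b) ∷ (b , c) ∷ (c , d) ∷ (d , a) ∷ []) t →
          Fwd D s t
  trit  : ∀ {u v w j} → (u , v) ∈ s → (v , w) ∈ s → Jewel D s j →
          Square u v w j →
          Replace s ((u , v) ∷ (v , w) ∷ []) ((u , j) ∷ (j , w) ∷ []) t →
          Fwd D s t

-- a flip or trit move between socks of G(R); moves may be applied in either
-- direction (this gives the "reverse" of flip (a) and removal in flip (c);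
-- reverses of (b) and trit are themselves (b) resp. trit moves)
Move : Region → Sock → Sock → Set
Move D s t = IsSock D s × IsSock D t × (Fwd D s t ⊎ Fwd D t s)

FlipTritHomotopic : Region → Sock → Sock → Set
FlipTritHomotopic D = Star (Move D)

{-# OPTIONS --safe #-}
module Submission where

-- Induction on μ s, the sum over the vertices v = (x , y) of s of 1 + (x + y - m), m a lower bound
-- of x + y on D.  Let p = (c , y₁) be the lexicographically largest vertex of s; after reversing
-- all cycles if necessary, s enters p from the left and leaves it downwards.  Following s down
-- column c until it turns left gives a bracket "]".  A bracket of height one is a unit square: it
-- is removed, or cut off by an inverse flip (a).  Otherwise consider the cell q diagonally
-- below-left of p.  If q is a jewel, a trit trades p for q.  Otherwise, depending on how s passes
-- through q, an inverse flip (a), possibly preceded by a flip (b), cuts off the corner at p, or s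
-- runs down column c - 1 from q and forms a lower bracket there, to which the argument is applied
-- again.  Each of these moves lowers μ.  Simple connectivity is needed only to know that q lies in
-- D: the winding number of s around the centre of the square spanned by p and q is negative (and
-- this passes to the nested brackets), whereas it vanishes around the corners of every cell
-- outside D, since such a cell is joined to infinity outside D.

open import Defs
open import Data.Empty using (⊥; ⊥-elim)
open import Data.Integer as ℤ
  using (ℤ; +_; -[1+_]; ∣_∣; _+_; _-_; _*_; -_; 0ℤ; 1ℤ; -1ℤ; pred; _<_; _≤_; _<?_)
open import Data.Integer.Base using () renaming (suc to sucℤ)
import Data.Integer.Properties as ℤ
open import Data.Integer.Tactic.RingSolver using (solve-∀)
open import Data.List using (List; []; _∷_; _++_; filter; map; foldr; deduplicate)
import Data.List.Extrema
open import Data.List.Membership.Propositional using (_∈_; _∉_; find; lose)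
open import Data.List.Membership.Propositional.Properties
  using (∈-++⁺ˡ; ∈-++⁺ʳ; ∈-++⁻; ∈-filter⁺; ∈-filter⁻; ∈-map⁺; ∈-map⁻
        ; ∈-deduplicate⁺; ∈-deduplicate⁻)
open import Data.List.Membership.Propositional.Properties.WithK using (unique∧set⇒bag)
import Data.List.Membership.DecPropositional as DecMembership
open import Data.List.Relation.Binary.BagAndSetEquality using (∼bag⇒↭)
open import Data.List.Relation.Binary.Permutation.Propositional
  using (_↭_; ↭-refl; ↭-sym; ↭-swap; ↭⇒↭ₛ)
open import Data.List.Relation.Binary.Permutation.Propositional.Properties
  using (∈-resp-↭; ↭-reverse; ++⁺ʳ) renaming (map⁺ to ↭-map⁺)
import Data.List.Relation.Binary.Permutation.Setoid.Properties as ↭ₛ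
import Data.List.Relation.Unary.All as All
open import Data.List.Relation.Unary.All using ([]; _∷_)
open import Data.List.Relation.Unary.All.Properties using (All¬⇒¬Any; ¬Any⇒All¬)
open import Data.List.Relation.Unary.AllPairs using ([]; _∷_)
open import Data.List.Relation.Unary.Any using (here; there; any?)
open import Data.List.Relation.Unary.Unique.Propositional using (Unique)
import Data.List.Relation.Unary.Unique.DecPropositional.Properties as Unique
open import Data.Nat as ℕ using (ℕ; zero; suc; z≤n; s≤s)
import Data.Nat.Properties as ℕ
open import Data.Product using (_×_; _,_; proj₁; proj₂; ∃; swap)
open import Data.Product.Properties using (≡-dec; ,-injectiveˡ; ,-injectiveʳ)
open import Data.Product.Relation.Binary.Lex.NonStrict using (×-totalOrder)
open import Data.Sum using (_⊎_; inj₁; inj₂)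
open import Function using (_∘_)
open import Function.Bundles using (mk⇔; Equivalence)
open import Relation.Binary.Bundles using (TotalOrder)
open import Relation.Binary.Construct.Closure.ReflexiveTransitive using (Star; ε; _◅_; _◅◅_)
open import Relation.Binary.Definitions using (DecidableEquality)
open import Relation.Binary.PropositionalEquality
open import Relation.Nullary using (¬_; Dec; yes; no; ¬?; _⊎-dec_)
open import Algebra.Properties.CommutativeSemigroup ℕ.+-commutativeSemigroup using (x∙yz≈y∙xz)

-- Grid geometry

right left up down downLeft : V → V
right (x , y) = (sucℤ x , y)
left  (x , y) = (pred x , y)
up    (x , y) = (x , sucℤ y)
down  (x , y) = (x , pred y)
downLeft p = left (down p)

i≢pred[i] : ∀ {i} → i ≢ pred i
i≢pred[i] {i} e = ℤ.i≢suc[i] (trans (sym (ℤ.suc-pred i)) (cong sucℤ (sym e)))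

i<suc[i] : ∀ i → i < sucℤ i
i<suc[i] i = ℤ.suc[i]≤j⇒i<j ℤ.≤-refl

pred[i]<i : ∀ i → pred i < i
pred[i]<i i = ℤ.i≤pred[j]⇒i<j ℤ.≤-refl

suc[i]≢i : ∀ {i} → sucℤ i ≢ i
suc[i]≢i e = ℤ.i≢suc[i] (sym e)

pred[i]≢i : ∀ {i} → pred i ≢ i
pred[i]≢i e = i≢pred[i] (sym e)

suc[suc[i]]≢i : ∀ {i} → sucℤ (sucℤ i) ≢ i
suc[suc[i]]≢i {i} e = ℤ.<-irrefl (sym e) (ℤ.<-trans (i<suc[i] i) (i<suc[i] (sucℤ i)))

pred[pred[i]]≢i : ∀ {i} → pred (pred i) ≢ i
pred[pred[i]]≢i {i} e = ℤ.<-irrefl e (ℤ.<-trans (pred[i]<i (pred i)) (pred[i]<i i))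

pred[i]≢suc[i] : ∀ {i} → pred i ≢ sucℤ i
pred[i]≢suc[i] {i} e = ℤ.<-irrefl e (ℤ.<-trans (pred[i]<i i) (i<suc[i] i))

i<suc[j]⇒i≤j : ∀ {i j} → i < sucℤ j → i ≤ j
i<suc[j]⇒i≤j {i} {j} h = subst (i ≤_) (ℤ.pred-suc j) (ℤ.i<j⇒i≤pred[j] h)

Adj-sym : ∀ a b → Adj a b → Adj b a
Adj-sym (x₁ , y₁) (x₂ , y₂) h
  rewrite ℤ.∣i-j∣≡∣j-i∣ x₂ x₁ | ℤ.∣i-j∣≡∣j-i∣ y₂ y₁ = h

Adj-irrefl : ∀ a b → Adj a b → a ≢ b
Adj-irrefl (x , y) _ h refl rewrite ℤ.+-inverseʳ x | ℤ.+-inverseʳ y with h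
... | ()

private
  i-pred[i] : ∀ i → i - (- 1ℤ + i) ≡ 1ℤ
  i-pred[i] = solve-∀

Adj-left : ∀ p → Adj p (left p)
Adj-left (x , y) rewrite i-pred[i] x | ℤ.+-inverseʳ y = refl

Adj-down : ∀ p → Adj p (down p)
Adj-down (x , y) rewrite i-pred[i] y | ℤ.+-inverseʳ x = refl

data Neighbour (p q : V) : Set where
  isRight : q ≡ right p → Neighbour p q
  isLeft  : q ≡ left p  → Neighbour p q
  isUp    : q ≡ up p    → Neighbour p q
  isDown  : q ≡ down p  → Neighbour p q

private
  ∣∣≡0⇒≡ : ∀ a b → ∣ a - b ∣ ≡ 0 → b ≡ a
  ∣∣≡0⇒≡ a b h = sym (ℤ.i-j≡0⇒i≡j a b (ℤ.∣i∣≡0⇒i≡0 h))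

  b≡a-[a-b] : ∀ a b → b ≡ a - (a - b)
  b≡a-[a-b] = solve-∀

  a-1≡pred[a] : ∀ a → a - 1ℤ ≡ - 1ℤ + a
  a-1≡pred[a] = solve-∀

  a+1≡suc[a] : ∀ a → a - - 1ℤ ≡ 1ℤ + a
  a+1≡suc[a] = solve-∀

  ∣∣≡1⇒suc⊎pred : ∀ a b → ∣ a - b ∣ ≡ 1 → b ≡ sucℤ a ⊎ b ≡ pred a
  ∣∣≡1⇒suc⊎pred a b h with a - b in eq
  ∣∣≡1⇒suc⊎pred a b refl | + .1 =
    inj₂ (trans (b≡a-[a-b] a b) (trans (cong (λ i → a - i) eq) (a-1≡pred[a] a)))
  ∣∣≡1⇒suc⊎pred a b refl | -[1+ 0 ] =
    inj₁ (trans (b≡a-[a-b] a b) (trans (cong (λ i → a - i) eq) (a+1≡suc[a] a)))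

  m+n≡1 : ∀ m n → m ℕ.+ n ≡ 1 → (m ≡ 0 × n ≡ 1) ⊎ (m ≡ 1 × n ≡ 0)
  m+n≡1 0 .1 refl = inj₁ (refl , refl)
  m+n≡1 1 0 refl = inj₂ (refl , refl)

Adj⇒Neighbour : ∀ {p q} → Adj p q → Neighbour p q
Adj⇒Neighbour {x₁ , y₁} {x₂ , y₂} h with m+n≡1 _ _ h
... | inj₁ (dx , dy) with ∣∣≡0⇒≡ x₁ x₂ dx | ∣∣≡1⇒suc⊎pred y₁ y₂ dy
...   | refl | inj₁ refl = isUp refl
...   | refl | inj₂ refl = isDown refl
Adj⇒Neighbour {x₁ , y₁} {x₂ , y₂} h | inj₂ (dx , dy)
  with ∣∣≡0⇒≡ y₁ y₂ dy | ∣∣≡1⇒suc⊎pred x₁ x₂ dx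
...   | refl | inj₁ refl = isRight refl
...   | refl | inj₂ refl = isLeft refl

Square-rotate : ∀ {a b c d} → Square a b c d → Square b c d a
Square-rotate (ab , bc , cd , da , a≢c , b≢d) = bc , cd , da , ab , b≢d , a≢c ∘ sym

Square-reverse : ∀ {a b c d} → Square a b c d → Square d c b a
Square-reverse {a} {b} {c} {d} (ab , bc , cd , da , a≢c , b≢d) =
  Adj-sym c d cd , Adj-sym b c bc , Adj-sym a b ab , Adj-sym d a da ,
  (λ e → b≢d (sym e)) , (λ e → a≢c (sym e))

Square-downLeft : ∀ p → Square p (down p) (downLeft p) (left p)
Square-downLeft p =
  Adj-down p , Adj-left (down p) , Adj-sym (left p) (downLeft p) (Adj-down (left p)) ,
  Adj-sym p (left p) (Adj-left p) ,
  (λ e → i≢pred[i] (cong proj₁ e)) , (λ e → i≢pred[i] (cong proj₁ e))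

-- Edge sets and the local moves

_≟V_ : DecidableEquality V
_≟V_ = ≡-dec ℤ._≟_ ℤ._≟_

_≟E_ : DecidableEquality Edge
_≟E_ = ≡-dec _≟V_ _≟V_

_∈E?_ : ∀ e (es : List Edge) → Dec (e ∈ es)
e ∈E? es = DecMembership._∈?_ _≟E_ e es

replace : Sock → List Edge → List Edge → Sock
replace s rem add = filter (λ e → ¬? (e ∈E? rem)) s ++ add

replace-correct : ∀ s rem add → Replace s rem add (replace s rem add)
replace-correct s rem add e = mk⇔ to from
  where
  kept : ∀ e → Dec (e ∉ rem)
  kept e = ¬? (e ∈E? rem)
  to : e ∈ replace s rem add → (e ∈ s × e ∉ rem) ⊎ e ∈ add
  to h with ∈-++⁻ (filter kept s) h
  ... | inj₁ h₁ = inj₁ (∈-filter⁻ kept h₁)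
  ... | inj₂ h₂ = inj₂ h₂
  from : (e ∈ s × e ∉ rem) ⊎ e ∈ add → e ∈ replace s rem add
  from (inj₁ (h , e∉rem)) = ∈-++⁺ˡ (∈-filter⁺ kept h e∉rem)
  from (inj₂ h) = ∈-++⁺ʳ _ h

module _ {s rem add t} (R : Replace s rem add t) where

  ∈-replace⁻ : ∀ {e} → e ∈ t → (e ∈ s × e ∉ rem) ⊎ e ∈ add
  ∈-replace⁻ {e} = Equivalence.to (R e)

  ∈-replace⁺ˡ : ∀ {e} → e ∈ s → e ∉ rem → e ∈ t
  ∈-replace⁺ˡ {e} h e∉rem = Equivalence.from (R e) (inj₁ (h , e∉rem))

  ∈-replace⁺ʳ : ∀ {e} → e ∈ add → e ∈ t
  ∈-replace⁺ʳ {e} h = Equivalence.from (R e) (inj₂ h)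

module SockProperties {D : Region} {s : Sock} (S : IsSock D s) where
  open IsSock S

  edge-Adj : ∀ {a b} → (a , b) ∈ s → Adj a b
  edge-Adj h = proj₂ (proj₂ (edges h))

  edge-≢ : ∀ {a b} → (a , b) ∈ s → a ≢ b
  edge-≢ {a} {b} h = Adj-irrefl a b (edge-Adj h)

  source∈D : ∀ {a b} → (a , b) ∈ s → a ∈ D
  source∈D h = proj₁ (edges h)

  target∈D : ∀ {a b} → (a , b) ∈ s → b ∈ D
  target∈D h = proj₁ (proj₂ (edges h))

  outEdge : ∀ {v} → OnSock s v → ∃ λ w → (v , w) ∈ s
  outEdge (w , inj₁ h) = w , h
  outEdge (w , inj₂ h) = next h

  inEdge : ∀ {v} → OnSock s v → ∃ λ w → (w , v) ∈ s
  inEdge (w , inj₁ h) = prev h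
  inEdge (w , inj₂ h) = w , h

  ¬OnSock-outside : ∀ {v} → v ∉ D → ¬ OnSock s v
  ¬OnSock-outside v∉D (w , inj₁ h) = v∉D (source∈D h)
  ¬OnSock-outside v∉D (w , inj₂ h) = v∉D (target∈D h)

module _ {D s j} (J : Jewel D s j) where

  Jewel⇒¬out : ∀ {x} → (j , x) ∉ s
  Jewel⇒¬out h = proj₂ J (_ , inj₁ h)

  Jewel⇒¬in : ∀ {x} → (x , j) ∉ s
  Jewel⇒¬in h = proj₂ J (_ , inj₂ h)

onSock? : ∀ s v → Dec (OnSock s v)
onSock? s v with any? (λ e → (proj₁ e ≟V v) ⊎-dec (proj₂ e ≟V v)) s
... | yes touches with find touches
...   | (x , y) , m , inj₁ refl = yes (y , inj₁ m)
...   | (x , y) , m , inj₂ refl = yes (x , inj₂ m)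
onSock? s v | no ¬touches = no λ where
  (w , inj₁ m) → ¬touches (lose m (inj₁ refl))
  (w , inj₂ m) → ¬touches (lose m (inj₂ refl))

module TritMove {D : Region} {s t : Sock} {u v w j : V} (S : IsSock D s)
  (uv : (u , v) ∈ s) (vw : (v , w) ∈ s) (J : Jewel D s j) (Q : Square u v w j)
  (R : Replace s ((u , v) ∷ (v , w) ∷ []) ((u , j) ∷ (j , w) ∷ []) t) where
  open IsSock S
  open SockProperties S
  private
    u≢v : u ≢ v
    u≢v = edge-≢ uv
    v≢w : v ≢ w
    v≢w = edge-≢ vw
    w≢j : w ≢ j
    w≢j = Adj-irrefl w j (proj₁ (proj₂ (proj₂ Q)))
    j≢u : j ≢ u
    j≢u = Adj-irrefl j u (proj₁ (proj₂ (proj₂ (proj₂ Q))))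
    u≢w : u ≢ w
    u≢w = proj₁ (proj₂ (proj₂ (proj₂ (proj₂ Q))))
    v≢j : v ≢ j
    v≢j = proj₂ (proj₂ (proj₂ (proj₂ (proj₂ Q))))

  data Origin (e : Edge) : Set where
    kept : e ∈ s → e ≢ (u , v) → e ≢ (v , w) → Origin e
    new₁ : e ≡ (u , j) → Origin e
    new₂ : e ≡ (j , w) → Origin e

  origin : ∀ {e} → e ∈ t → Origin e
  origin h with ∈-replace⁻ R h
  ... | inj₁ (h' , e∉rem) with ¬Any⇒All¬ _ e∉rem
  ...   | p ∷ q ∷ [] = kept h' p q
  origin h | inj₂ (here p) = new₁ p
  origin h | inj₂ (there (here p)) = new₂ p

  keep : ∀ {e} → e ∈ s → e ≢ (u , v) → e ≢ (v , w) → e ∈ t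
  keep h p q = ∈-replace⁺ˡ R h (All¬⇒¬Any (p ∷ q ∷ []))

  uj∈t : (u , j) ∈ t
  uj∈t = ∈-replace⁺ʳ R (here refl)

  jw∈t : (j , w) ∈ t
  jw∈t = ∈-replace⁺ʳ R (there (here refl))

  edgesT : ∀ {a b} → (a , b) ∈ t → a ∈ D × b ∈ D × Adj a b
  edgesT h with origin h
  ... | kept h' _ _ = edges h'
  ... | new₁ refl = source∈D uv , proj₁ J , Adj-sym j u (proj₁ (proj₂ (proj₂ (proj₂ Q))))
  ... | new₂ refl = proj₁ J , target∈D vw , Adj-sym w j (proj₁ (proj₂ (proj₂ Q)))

  outUniqT : ∀ {a b b'} → (a , b) ∈ t → (a , b') ∈ t → b ≡ b'
  outUniqT h h' with origin h | origin h'
  ... | kept x _ _ | kept y _ _ = outUniq x y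
  ... | kept x p _ | new₁ refl = ⊥-elim (p (cong (u ,_) (outUniq x uv)))
  ... | kept x _ _ | new₂ refl = ⊥-elim (Jewel⇒¬out J x)
  ... | new₁ refl | kept y p _ = ⊥-elim (p (cong (u ,_) (outUniq y uv)))
  ... | new₂ refl | kept y _ _ = ⊥-elim (Jewel⇒¬out J y)
  ... | new₁ refl | new₁ refl = refl
  ... | new₂ refl | new₂ refl = refl
  ... | new₁ e₁ | new₂ e₂ = ⊥-elim (j≢u (trans (sym (,-injectiveˡ e₂)) (,-injectiveˡ e₁)))
  ... | new₂ e₁ | new₁ e₂ = ⊥-elim (j≢u (trans (sym (,-injectiveˡ e₁)) (,-injectiveˡ e₂)))

  inUniqT : ∀ {a a' b} → (a , b) ∈ t → (a' , b) ∈ t → a ≡ a'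
  inUniqT h h' with origin h | origin h'
  ... | kept x _ _ | kept y _ _ = inUniq x y
  ... | kept x _ q | new₂ refl = ⊥-elim (q (cong (_, w) (inUniq x vw)))
  ... | kept x _ _ | new₁ refl = ⊥-elim (Jewel⇒¬in J x)
  ... | new₂ refl | kept y _ q = ⊥-elim (q (cong (_, w) (inUniq y vw)))
  ... | new₁ refl | kept y _ _ = ⊥-elim (Jewel⇒¬in J y)
  ... | new₁ refl | new₁ refl = refl
  ... | new₂ refl | new₂ refl = refl
  ... | new₁ e₁ | new₂ e₂ = ⊥-elim (w≢j (trans (sym (,-injectiveʳ e₂)) (,-injectiveʳ e₁)))
  ... | new₂ e₁ | new₁ e₂ = ⊥-elim (w≢j (trans (sym (,-injectiveʳ e₁)) (,-injectiveʳ e₂)))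

  nextT : ∀ {a b} → (a , b) ∈ t → ∃ λ c → (b , c) ∈ t
  nextT h with origin h
  ... | new₁ refl = w , jw∈t
  ... | new₂ refl with next vw
  ...   | c , wc = c , keep wc (u≢w ∘ sym ∘ ,-injectiveˡ) (v≢w ∘ sym ∘ ,-injectiveˡ)
  nextT {b = b} h | kept x p _ with next x
  ...   | c , bc with (b , c) ≟E (u , v) | (b , c) ≟E (v , w)
  ...     | yes refl | _ = j , uj∈t
  ...     | no _ | yes refl = ⊥-elim (p (cong (_, v) (inUniq x uv)))
  ...     | no r₁ | no r₂ = c , keep bc r₁ r₂

  prevT : ∀ {a b} → (a , b) ∈ t → ∃ λ c → (c , a) ∈ t
  prevT h with origin h
  ... | new₂ refl = u , uj∈t
  ... | new₁ refl with prev uv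
  ...   | c , cu = c , keep cu (u≢v ∘ ,-injectiveʳ) (u≢w ∘ ,-injectiveʳ)
  prevT {a = a} h | kept x _ q with prev x
  ...   | c , ca with (c , a) ≟E (v , w) | (c , a) ≟E (u , v)
  ...     | yes refl | _ = j , jw∈t
  ...     | no _ | yes refl = ⊥-elim (q (cong (v ,_) (outUniq x vw)))
  ...     | no r₁ | no r₂ = c , keep ca r₂ r₁

  noBackT : ∀ {a b} → (a , b) ∈ t → (b , a) ∉ t
  noBackT h h' with origin h | origin h'
  ... | kept x _ _ | kept y _ _ = noBack x y
  ... | kept x _ _ | new₁ refl = Jewel⇒¬out J x
  ... | kept x _ _ | new₂ refl = Jewel⇒¬in J x
  ... | new₁ refl | kept y _ _ = Jewel⇒¬out J y
  ... | new₂ refl | kept y _ _ = Jewel⇒¬in J y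
  ... | new₁ refl | new₁ e = j≢u (,-injectiveˡ e)
  ... | new₁ refl | new₂ e = u≢w (,-injectiveʳ e)
  ... | new₂ refl | new₁ e = u≢w (sym (,-injectiveˡ e))
  ... | new₂ refl | new₂ e = w≢j (,-injectiveˡ e)

  isSock : IsSock D t
  isSock = record
    { edges = edgesT ; outUniq = outUniqT ; inUniq = inUniqT
    ; next = nextT ; prev = prevT ; noBack = noBackT }

  onSock-reflect : ∀ d → d ≢ j → OnSock t d → OnSock s d
  onSock-reflect d d≢j (z , inj₁ h) with origin h
  ... | kept h' _ _ = z , inj₁ h'
  ... | new₁ refl = v , inj₁ uv
  ... | new₂ refl = ⊥-elim (d≢j refl)
  onSock-reflect d d≢j (z , inj₂ h) with origin h
  ... | kept h' _ _ = z , inj₂ h'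
  ... | new₁ refl = ⊥-elim (d≢j refl)
  ... | new₂ refl = v , inj₂ vw

  v-off : ¬ OnSock t v
  v-off (z , inj₁ h) with origin h
  ... | kept h' _ q = q (cong (v ,_) (outUniq h' vw))
  ... | new₁ e = u≢v (sym (,-injectiveˡ e))
  ... | new₂ e = v≢j (,-injectiveˡ e)
  v-off (z , inj₂ h) with origin h
  ... | kept h' p _ = p (cong (_, v) (inUniq h' uv))
  ... | new₁ e = v≢j (,-injectiveʳ e)
  ... | new₂ e = v≢w (,-injectiveʳ e)

  j-on : OnSock t j
  j-on = u , inj₂ uj∈t

module ShortcutMove {D : Region} {s t : Sock} {u a b v : V} (S : IsSock D s)
  (ua : (u , a) ∈ s) (ab : (a , b) ∈ s) (bv : (b , v) ∈ s) (Q : Square u v b a)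
  (vu∉s : (v , u) ∉ s)
  (R : Replace s ((u , a) ∷ (a , b) ∷ (b , v) ∷ []) ((u , v) ∷ []) t) where
  open IsSock S
  open SockProperties S
  private
    u≢v : u ≢ v
    u≢v = Adj-irrefl u v (proj₁ Q)
    u≢a : u ≢ a
    u≢a = edge-≢ ua
    b≢v : b ≢ v
    b≢v = edge-≢ bv
    u≢b : u ≢ b
    u≢b = proj₁ (proj₂ (proj₂ (proj₂ (proj₂ Q))))
    v≢a : v ≢ a
    v≢a = proj₂ (proj₂ (proj₂ (proj₂ (proj₂ Q))))

  data Origin (e : Edge) : Set where
    kept : e ∈ s → e ≢ (u , a) → e ≢ (a , b) → e ≢ (b , v) → Origin e
    new  : e ≡ (u , v) → Origin e

  origin : ∀ {e} → e ∈ t → Origin e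
  origin h with ∈-replace⁻ R h
  ... | inj₁ (h' , e∉rem) with ¬Any⇒All¬ _ e∉rem
  ...   | p ∷ q ∷ r ∷ [] = kept h' p q r
  origin h | inj₂ (here p) = new p

  keep : ∀ {e} → e ∈ s → e ≢ (u , a) → e ≢ (a , b) → e ≢ (b , v) → e ∈ t
  keep h p q r = ∈-replace⁺ˡ R h (All¬⇒¬Any (p ∷ q ∷ r ∷ []))

  uv∈t : (u , v) ∈ t
  uv∈t = ∈-replace⁺ʳ R (here refl)

  edgesT : ∀ {x y} → (x , y) ∈ t → x ∈ D × y ∈ D × Adj x y
  edgesT h with origin h
  ... | kept h' _ _ _ = edges h'
  ... | new refl = source∈D ua , target∈D bv , proj₁ Q

  outUniqT : ∀ {x y y'} → (x , y) ∈ t → (x , y') ∈ t → y ≡ y'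
  outUniqT h h' with origin h | origin h'
  ... | kept p _ _ _ | kept q _ _ _ = outUniq p q
  ... | kept p r _ _ | new refl = ⊥-elim (r (cong (u ,_) (outUniq p ua)))
  ... | new refl | kept p r _ _ = ⊥-elim (r (cong (u ,_) (outUniq p ua)))
  ... | new refl | new refl = refl

  inUniqT : ∀ {x x' y} → (x , y) ∈ t → (x' , y) ∈ t → x ≡ x'
  inUniqT h h' with origin h | origin h'
  ... | kept p _ _ _ | kept q _ _ _ = inUniq p q
  ... | kept p _ _ r | new refl = ⊥-elim (r (cong (_, v) (inUniq p bv)))
  ... | new refl | kept p _ _ r = ⊥-elim (r (cong (_, v) (inUniq p bv)))
  ... | new refl | new refl = refl

  nextT : ∀ {x y} → (x , y) ∈ t → ∃ λ z → (y , z) ∈ t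
  nextT h with origin h
  ... | new refl with next bv
  ...   | z , vz =
    z , keep vz (u≢v ∘ sym ∘ ,-injectiveˡ) (v≢a ∘ ,-injectiveˡ) (b≢v ∘ sym ∘ ,-injectiveˡ)
  nextT {y = y} h | kept p r₁ r₂ _ with next p
  ...   | z , yz with (y , z) ≟E (u , a) | (y , z) ≟E (a , b) | (y , z) ≟E (b , v)
  ...     | yes refl | _ | _ = v , uv∈t
  ...     | no _ | yes refl | _ = ⊥-elim (r₁ (cong (_, a) (inUniq p ua)))
  ...     | no _ | no _ | yes refl = ⊥-elim (r₂ (cong (_, b) (inUniq p ab)))
  ...     | no q₁ | no q₂ | no q₃ = z , keep yz q₁ q₂ q₃

  prevT : ∀ {x y} → (x , y) ∈ t → ∃ λ z → (z , x) ∈ t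
  prevT h with origin h
  ... | new refl with prev ua
  ...   | z , zu = z , keep zu (u≢a ∘ ,-injectiveʳ) (u≢b ∘ ,-injectiveʳ) (u≢v ∘ ,-injectiveʳ)
  prevT {x = x} h | kept p _ r₂ r₃ with prev p
  ...   | z , zx with (z , x) ≟E (b , v) | (z , x) ≟E (a , b) | (z , x) ≟E (u , a)
  ...     | yes refl | _ | _ = u , uv∈t
  ...     | no _ | yes refl | _ = ⊥-elim (r₃ (cong (b ,_) (outUniq p bv)))
  ...     | no _ | no _ | yes refl = ⊥-elim (r₂ (cong (a ,_) (outUniq p ab)))
  ...     | no q₁ | no q₂ | no q₃ = z , keep zx q₃ q₂ q₁

  noBackT : ∀ {x y} → (x , y) ∈ t → (y , x) ∉ t
  noBackT h h' with origin h | origin h'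
  ... | kept p _ _ _ | kept q _ _ _ = noBack p q
  ... | kept p _ _ _ | new refl = vu∉s p
  ... | new refl | kept p _ _ _ = vu∉s p
  ... | new refl | new e = u≢v (,-injectiveʳ e)

  isSock : IsSock D t
  isSock = record
    { edges = edgesT ; outUniq = outUniqT ; inUniq = inUniqT
    ; next = nextT ; prev = prevT ; noBack = noBackT }

  a-jewel : Jewel D t a
  a-jewel = source∈D ab , a-off
    where
    a-off : ¬ OnSock t a
    a-off (z , inj₁ h) with origin h
    ... | kept p _ r _ = r (cong (a ,_) (outUniq p ab))
    ... | new e = u≢a (sym (,-injectiveˡ e))
    a-off (z , inj₂ h) with origin h
    ... | kept p r _ _ = r (cong (_, a) (inUniq p ua))
    ... | new e = v≢a (sym (,-injectiveʳ e))

  b-jewel : Jewel D t b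
  b-jewel = source∈D bv , b-off
    where
    b-off : ¬ OnSock t b
    b-off (z , inj₁ h) with origin h
    ... | kept p _ _ r = r (cong (b ,_) (outUniq p bv))
    ... | new e = u≢b (sym (,-injectiveˡ e))
    b-off (z , inj₂ h) with origin h
    ... | kept p _ r _ = r (cong (_, b) (inUniq p ab))
    ... | new e = b≢v (,-injectiveʳ e)

  inverse : Replace t ((u , v) ∷ []) ((u , a) ∷ (a , b) ∷ (b , v) ∷ []) s
  inverse e = mk⇔ to from
    where
    to : e ∈ s → (e ∈ t × e ∉ (u , v) ∷ []) ⊎ e ∈ (u , a) ∷ (a , b) ∷ (b , v) ∷ []
    to h with e ≟E (u , a) | e ≟E (a , b) | e ≟E (b , v)
    ... | yes p | _ | _ = inj₂ (here p)
    ... | no _ | yes p | _ = inj₂ (there (here p))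
    ... | no _ | no _ | yes p = inj₂ (there (there (here p)))
    ... | no p | no q | no r = inj₁ (keep h p q r , λ { (here refl) → v≢a (outUniq h ua) })
    from : (e ∈ t × e ∉ (u , v) ∷ []) ⊎ e ∈ (u , a) ∷ (a , b) ∷ (b , v) ∷ [] → e ∈ s
    from (inj₁ (h , e≢uv)) with origin h
    ... | kept p _ _ _ = p
    ... | new refl = ⊥-elim (e≢uv (here refl))
    from (inj₂ (here refl)) = ua
    from (inj₂ (there (here refl))) = ab
    from (inj₂ (there (there (here refl)))) = bv

  move : Fwd D t s
  move = flipA uv∈t a-jewel b-jewel Q inverse

  onSock-reflect : ∀ d → OnSock t d → OnSock s d
  onSock-reflect d (z , inj₁ h) with origin h
  ... | kept h' _ _ _ = z , inj₁ h'
  ... | new refl = a , inj₁ ua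
  onSock-reflect d (z , inj₂ h) with origin h
  ... | kept h' _ _ _ = z , inj₂ h'
  ... | new refl = b , inj₂ bv

module SquareRemoval {D : Region} {s t : Sock} {a b c d : V} (S : IsSock D s)
  (ab : (a , b) ∈ s) (bc : (b , c) ∈ s) (cd : (c , d) ∈ s) (da : (d , a) ∈ s) (Q : Square a b c d)
  (R : Replace s ((a , b) ∷ (b , c) ∷ (c , d) ∷ (d , a) ∷ []) [] t) where
  open IsSock S
  open SockProperties S

  cycle : List Edge
  cycle = (a , b) ∷ (b , c) ∷ (c , d) ∷ (d , a) ∷ []

  origin : ∀ {e} → e ∈ t → e ∈ s × e ∉ cycle
  origin h with ∈-replace⁻ R h
  ... | inj₁ kept = kept

  in-cycle⇒pred-in-cycle : ∀ {x y z} → (x , y) ∈ s → (y , z) ∈ cycle → (x , y) ∈ cycle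
  in-cycle⇒pred-in-cycle p (here refl) = there (there (there (here (cong (_, a) (inUniq p da)))))
  in-cycle⇒pred-in-cycle p (there (here refl)) = here (cong (_, b) (inUniq p ab))
  in-cycle⇒pred-in-cycle p (there (there (here refl))) = there (here (cong (_, c) (inUniq p bc)))
  in-cycle⇒pred-in-cycle p (there (there (there (here refl)))) =
    there (there (here (cong (_, d) (inUniq p cd))))

  in-cycle⇒succ-in-cycle : ∀ {x y z} → (x , y) ∈ s → (z , x) ∈ cycle → (x , y) ∈ cycle
  in-cycle⇒succ-in-cycle p (here refl) = there (here (cong (b ,_) (outUniq p bc)))
  in-cycle⇒succ-in-cycle p (there (here refl)) = there (there (here (cong (c ,_) (outUniq p cd))))
  in-cycle⇒succ-in-cycle p (there (there (here refl))) =
    there (there (there (here (cong (d ,_) (outUniq p da)))))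
  in-cycle⇒succ-in-cycle p (there (there (there (here refl)))) = here (cong (a ,_) (outUniq p ab))

  nextT : ∀ {x y} → (x , y) ∈ t → ∃ λ z → (y , z) ∈ t
  nextT {y = y} h with origin h
  ... | p , p∉cycle with next p
  ...   | z , yz with (y , z) ∈E? cycle
  ...     | yes m = ⊥-elim (p∉cycle (in-cycle⇒pred-in-cycle p m))
  ...     | no m = z , ∈-replace⁺ˡ R yz m

  prevT : ∀ {x y} → (x , y) ∈ t → ∃ λ z → (z , x) ∈ t
  prevT {x = x} h with origin h
  ... | p , p∉cycle with prev p
  ...   | z , zx with (z , x) ∈E? cycle
  ...     | yes m = ⊥-elim (p∉cycle (in-cycle⇒succ-in-cycle p m))
  ...     | no m = z , ∈-replace⁺ˡ R zx m

  isSock : IsSock D t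
  isSock = record
    { edges = λ h → edges (proj₁ (origin h))
    ; outUniq = λ h h' → outUniq (proj₁ (origin h)) (proj₁ (origin h'))
    ; inUniq = λ h h' → inUniq (proj₁ (origin h)) (proj₁ (origin h'))
    ; next = nextT ; prev = prevT
    ; noBack = λ h h' → noBack (proj₁ (origin h)) (proj₁ (origin h')) }

  cycle-jewel : ∀ {x y z} → (x , y) ∈ cycle → (z , x) ∈ cycle → (x , y) ∈ s → Jewel D t x
  cycle-jewel m m' p = source∈D p , x-off
    where
    x-off : ¬ OnSock t _
    x-off (w , inj₁ h) = proj₂ (origin h) (in-cycle⇒succ-in-cycle (proj₁ (origin h)) m')
    x-off (w , inj₂ h) = proj₂ (origin h) (in-cycle⇒pred-in-cycle (proj₁ (origin h)) m)

  a-jewel : Jewel D t a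
  a-jewel = cycle-jewel (here refl) (there (there (there (here refl)))) ab

  inverse : Replace t [] cycle s
  inverse e = mk⇔ to from
    where
    to : e ∈ s → (e ∈ t × e ∉ []) ⊎ e ∈ cycle
    to h with e ∈E? cycle
    ... | yes m = inj₂ m
    ... | no m = inj₁ (∈-replace⁺ˡ R h m , λ ())
    from : (e ∈ t × e ∉ []) ⊎ e ∈ cycle → e ∈ s
    from (inj₁ (h , _)) = proj₁ (origin h)
    from (inj₂ (here refl)) = ab
    from (inj₂ (there (here refl))) = bc
    from (inj₂ (there (there (here refl)))) = cd
    from (inj₂ (there (there (there (here refl))))) = da

  move : Fwd D t s
  move = flipC a-jewel
               (cycle-jewel (there (here refl)) (here refl) bc)
               (cycle-jewel (there (there (here refl))) (there (here refl)) cd)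
               (cycle-jewel (there (there (there (here refl)))) (there (there (here refl))) da)
               Q inverse

  onSock-reflect : ∀ x → OnSock t x → OnSock s x
  onSock-reflect x (z , inj₁ h) = z , inj₁ (proj₁ (origin h))
  onSock-reflect x (z , inj₂ h) = z , inj₂ (proj₁ (origin h))

module CrossFlip {D : Region} {s t : Sock} {u v w x : V} (S : IsSock D s)
  (uv : (u , v) ∈ s) (wx : (w , x) ∈ s) (Q : Square u v w x)
  (xu∉s : (x , u) ∉ s) (vw∉s : (v , w) ∉ s)
  (R : Replace s ((u , v) ∷ (w , x) ∷ []) ((u , x) ∷ (w , v) ∷ []) t) where
  open IsSock S
  open SockProperties S
  private
    Avw : Adj v w
    Avw = proj₁ (proj₂ Q)
    Axu : Adj x u
    Axu = proj₁ (proj₂ (proj₂ (proj₂ Q)))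
    u≢w : u ≢ w
    u≢w = proj₁ (proj₂ (proj₂ (proj₂ (proj₂ Q))))
    v≢x : v ≢ x
    v≢x = proj₂ (proj₂ (proj₂ (proj₂ (proj₂ Q))))
    u≢v : u ≢ v
    u≢v = edge-≢ uv
    w≢x : w ≢ x
    w≢x = edge-≢ wx
    v≢w : v ≢ w
    v≢w = Adj-irrefl v w Avw
    x≢u : x ≢ u
    x≢u = Adj-irrefl x u Axu

  data Origin (e : Edge) : Set where
    kept : e ∈ s → e ≢ (u , v) → e ≢ (w , x) → Origin e
    new₁ : e ≡ (u , x) → Origin e
    new₂ : e ≡ (w , v) → Origin e

  origin : ∀ {e} → e ∈ t → Origin e
  origin h with ∈-replace⁻ R h
  ... | inj₁ (h' , e∉rem) with ¬Any⇒All¬ _ e∉rem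
  ...   | p ∷ q ∷ [] = kept h' p q
  origin h | inj₂ (here p) = new₁ p
  origin h | inj₂ (there (here p)) = new₂ p

  keep : ∀ {e} → e ∈ s → e ≢ (u , v) → e ≢ (w , x) → e ∈ t
  keep h p q = ∈-replace⁺ˡ R h (All¬⇒¬Any (p ∷ q ∷ []))

  ux∈t : (u , x) ∈ t
  ux∈t = ∈-replace⁺ʳ R (here refl)

  wv∈t : (w , v) ∈ t
  wv∈t = ∈-replace⁺ʳ R (there (here refl))

  edgesT : ∀ {a b} → (a , b) ∈ t → a ∈ D × b ∈ D × Adj a b
  edgesT h with origin h
  ... | kept h' _ _ = edges h'
  ... | new₁ refl = source∈D uv , target∈D wx , Adj-sym x u Axu
  ... | new₂ refl = source∈D wx , target∈D uv , Adj-sym v w Avw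

  outUniqT : ∀ {a b b'} → (a , b) ∈ t → (a , b') ∈ t → b ≡ b'
  outUniqT h h' with origin h | origin h'
  ... | kept p _ _ | kept q _ _ = outUniq p q
  ... | kept p r _ | new₁ refl = ⊥-elim (r (cong (u ,_) (outUniq p uv)))
  ... | kept p _ r | new₂ refl = ⊥-elim (r (cong (w ,_) (outUniq p wx)))
  ... | new₁ refl | kept p r _ = ⊥-elim (r (cong (u ,_) (outUniq p uv)))
  ... | new₂ refl | kept p _ r = ⊥-elim (r (cong (w ,_) (outUniq p wx)))
  ... | new₁ refl | new₁ refl = refl
  ... | new₂ refl | new₂ refl = refl
  ... | new₁ refl | new₂ e = ⊥-elim (u≢w (,-injectiveˡ e))
  ... | new₂ refl | new₁ e = ⊥-elim (u≢w (sym (,-injectiveˡ e)))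

  inUniqT : ∀ {a a' b} → (a , b) ∈ t → (a' , b) ∈ t → a ≡ a'
  inUniqT h h' with origin h | origin h'
  ... | kept p _ _ | kept q _ _ = inUniq p q
  ... | kept p _ r | new₁ refl = ⊥-elim (r (cong (_, x) (inUniq p wx)))
  ... | kept p r _ | new₂ refl = ⊥-elim (r (cong (_, v) (inUniq p uv)))
  ... | new₁ refl | kept p _ r = ⊥-elim (r (cong (_, x) (inUniq p wx)))
  ... | new₂ refl | kept p r _ = ⊥-elim (r (cong (_, v) (inUniq p uv)))
  ... | new₁ refl | new₁ refl = refl
  ... | new₂ refl | new₂ refl = refl
  ... | new₁ refl | new₂ e = ⊥-elim (v≢x (sym (,-injectiveʳ e)))
  ... | new₂ refl | new₁ e = ⊥-elim (v≢x (,-injectiveʳ e))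

  nextT : ∀ {a b} → (a , b) ∈ t → ∃ λ c → (b , c) ∈ t
  nextT h with origin h
  ... | new₁ refl with next wx
  ...   | c , xc = c , keep xc (x≢u ∘ ,-injectiveˡ) (w≢x ∘ sym ∘ ,-injectiveˡ)
  nextT h | new₂ refl with next uv
  ...   | c , vc = c , keep vc (u≢v ∘ sym ∘ ,-injectiveˡ) (v≢w ∘ ,-injectiveˡ)
  nextT {b = b} h | kept p _ _ with next p
  ...   | c , bc with (b , c) ≟E (u , v) | (b , c) ≟E (w , x)
  ...     | yes refl | _ = x , ux∈t
  ...     | no _ | yes refl = v , wv∈t
  ...     | no q₁ | no q₂ = c , keep bc q₁ q₂

  prevT : ∀ {a b} → (a , b) ∈ t → ∃ λ c → (c , a) ∈ t
  prevT h with origin h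
  ... | new₁ refl with prev uv
  ...   | c , cu = c , keep cu (u≢v ∘ ,-injectiveʳ) (x≢u ∘ sym ∘ ,-injectiveʳ)
  prevT h | new₂ refl with prev wx
  ...   | c , cw = c , keep cw (v≢w ∘ sym ∘ ,-injectiveʳ) (w≢x ∘ ,-injectiveʳ)
  prevT {a = a} h | kept p _ _ with prev p
  ...   | c , ca with (c , a) ≟E (u , v) | (c , a) ≟E (w , x)
  ...     | yes refl | _ = w , wv∈t
  ...     | no _ | yes refl = u , ux∈t
  ...     | no q₁ | no q₂ = c , keep ca q₁ q₂

  noBackT : ∀ {a b} → (a , b) ∈ t → (b , a) ∉ t
  noBackT h h' with origin h | origin h'
  ... | kept p _ _ | kept q _ _ = noBack p q
  ... | kept p _ _ | new₁ refl = xu∉s p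
  ... | kept p _ _ | new₂ refl = vw∉s p
  ... | new₁ refl | kept p _ _ = xu∉s p
  ... | new₂ refl | kept p _ _ = vw∉s p
  ... | new₁ refl | new₁ e = x≢u (,-injectiveˡ e)
  ... | new₁ refl | new₂ e = w≢x (sym (,-injectiveˡ e))
  ... | new₂ refl | new₁ e = u≢v (sym (,-injectiveˡ e))
  ... | new₂ refl | new₂ e = v≢w (,-injectiveˡ e)

  isSock : IsSock D t
  isSock = record
    { edges = edgesT ; outUniq = outUniqT ; inUniq = inUniqT
    ; next = nextT ; prev = prevT ; noBack = noBackT }

  onSock-reflect : ∀ d → OnSock t d → OnSock s d
  onSock-reflect d (z , inj₁ h) with origin h
  ... | kept h' _ _ = z , inj₁ h'
  ... | new₁ refl = v , inj₁ uv
  ... | new₂ refl = x , inj₁ wx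
  onSock-reflect d (z , inj₂ h) with origin h
  ... | kept h' _ _ = z , inj₂ h'
  ... | new₁ refl = w , inj₂ wx
  ... | new₂ refl = u , inj₂ uv

-- Reversing all cycles

reverseEdges : List Edge → List Edge
reverseEdges = map swap

reverseEdges-involutive : ∀ es → reverseEdges (reverseEdges es) ≡ es
reverseEdges-involutive [] = refl
reverseEdges-involutive (e ∷ es) = cong (e ∷_) (reverseEdges-involutive es)

∈-reverseEdges⁺ : ∀ {a b es} → (a , b) ∈ es → (b , a) ∈ reverseEdges es
∈-reverseEdges⁺ = ∈-map⁺ swap

∈-reverseEdges⁻ : ∀ {a b es} → (a , b) ∈ reverseEdges es → (b , a) ∈ es
∈-reverseEdges⁻ h with ∈-map⁻ swap h
... | _ , h' , refl = h'

OnSock-reverse⁺ : ∀ {s d} → OnSock s d → OnSock (reverseEdges s) d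
OnSock-reverse⁺ (z , inj₁ h) = z , inj₂ (∈-reverseEdges⁺ h)
OnSock-reverse⁺ (z , inj₂ h) = z , inj₁ (∈-reverseEdges⁺ h)

OnSock-reverse⁻ : ∀ {s d} → OnSock (reverseEdges s) d → OnSock s d
OnSock-reverse⁻ (z , inj₁ h) = z , inj₂ (∈-reverseEdges⁻ h)
OnSock-reverse⁻ (z , inj₂ h) = z , inj₁ (∈-reverseEdges⁻ h)

Jewel-reverse : ∀ {D s j} → Jewel D s j → Jewel D (reverseEdges s) j
Jewel-reverse (j∈D , j-off) = j∈D , λ on → j-off (OnSock-reverse⁻ on)

IsSock-reverse : ∀ {D s} → IsSock D s → IsSock D (reverseEdges s)
IsSock-reverse {D} {s} S = record
  { edges = edgesR
  ; outUniq = λ h h' → inUniq (∈-reverseEdges⁻ h) (∈-reverseEdges⁻ h')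
  ; inUniq = λ h h' → outUniq (∈-reverseEdges⁻ h) (∈-reverseEdges⁻ h')
  ; next = λ h → let (w , m) = prev (∈-reverseEdges⁻ h) in w , ∈-reverseEdges⁺ m
  ; prev = λ h → let (w , m) = next (∈-reverseEdges⁻ h) in w , ∈-reverseEdges⁺ m
  ; noBack = λ h h' → noBack (∈-reverseEdges⁻ h) (∈-reverseEdges⁻ h') }
  where
  open IsSock S
  edgesR : ∀ {a b} → (a , b) ∈ reverseEdges s → a ∈ D × b ∈ D × Adj a b
  edgesR {a} {b} h with edges (∈-reverseEdges⁻ h)
  ... | b∈D , a∈D , ba = a∈D , b∈D , Adj-sym b a ba

Replace-reverse : ∀ {s rem add t} → Replace s rem add t →
                  Replace (reverseEdges s) (reverseEdges rem) (reverseEdges add) (reverseEdges t)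
Replace-reverse {s} {rem} {add} {t} R e = mk⇔ to from
  where
  to : e ∈ reverseEdges t → (e ∈ reverseEdges s × e ∉ reverseEdges rem) ⊎ e ∈ reverseEdges add
  to h with ∈-replace⁻ R (∈-reverseEdges⁻ h)
  ... | inj₁ (h' , ∉rem) = inj₁ (∈-reverseEdges⁺ h' , λ m → ∉rem (∈-reverseEdges⁻ m))
  ... | inj₂ h' = inj₂ (∈-reverseEdges⁺ h')
  from : (e ∈ reverseEdges s × e ∉ reverseEdges rem) ⊎ e ∈ reverseEdges add → e ∈ reverseEdges t
  from (inj₁ (h , ∉rem)) =
    ∈-reverseEdges⁺ (∈-replace⁺ˡ R (∈-reverseEdges⁻ h) (λ m → ∉rem (∈-reverseEdges⁺ m)))
  from (inj₂ h) = ∈-reverseEdges⁺ (∈-replace⁺ʳ R (∈-reverseEdges⁻ h))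

Replace-resp-↭ : ∀ {s rem add t rem' add'} → rem ↭ rem' → add ↭ add' →
                 Replace s rem add t → Replace s rem' add' t
Replace-resp-↭ {s} {rem} {add} {t} {rem'} {add'} rem↭ add↭ R e = mk⇔ to from
  where
  to : e ∈ t → (e ∈ s × e ∉ rem') ⊎ e ∈ add'
  to h with ∈-replace⁻ R h
  ... | inj₁ (h' , ∉rem) = inj₁ (h' , λ m → ∉rem (∈-resp-↭ (↭-sym rem↭) m))
  ... | inj₂ h' = inj₂ (∈-resp-↭ add↭ h')
  from : (e ∈ s × e ∉ rem') ⊎ e ∈ add' → e ∈ t
  from (inj₁ (h , ∉rem')) = ∈-replace⁺ˡ R h (λ m → ∉rem' (∈-resp-↭ rem↭ m))
  from (inj₂ h) = ∈-replace⁺ʳ R (∈-resp-↭ (↭-sym add↭) h)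

Fwd-reverse : ∀ {D s t} → Fwd D s t → Fwd D (reverseEdges s) (reverseEdges t)
Fwd-reverse (flipA uv J J' Q R) =
  flipA (∈-reverseEdges⁺ uv) (Jewel-reverse J') (Jewel-reverse J)
        (Square-rotate (Square-rotate (Square-reverse Q)))
        (Replace-resp-↭ ↭-refl (↭-sym (↭-reverse _)) (Replace-reverse R))
Fwd-reverse (flipB uv wx Q R) =
  flipB (∈-reverseEdges⁺ wx) (∈-reverseEdges⁺ uv) (Square-reverse Q)
        (Replace-resp-↭ (↭-swap _ _ ↭-refl) ↭-refl (Replace-reverse R))
Fwd-reverse (flipC Ja Jb Jc Jd Q R) =
  flipC (Jewel-reverse Jd) (Jewel-reverse Jc) (Jewel-reverse Jb) (Jewel-reverse Ja) (Square-reverse Q)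
        (Replace-resp-↭ ↭-refl (++⁺ʳ (_ ∷ []) (↭-sym (↭-reverse (_ ∷ _ ∷ _ ∷ []))))
                        (Replace-reverse R))
Fwd-reverse (trit uv vw J Q R) =
  trit (∈-reverseEdges⁺ vw) (∈-reverseEdges⁺ uv) (Jewel-reverse J) (Square-rotate (Square-reverse Q))
       (Replace-resp-↭ (↭-swap _ _ ↭-refl) (↭-swap _ _ ↭-refl) (Replace-reverse R))

Move-reverse : ∀ {D s t} → Move D s t → Move D (reverseEdges s) (reverseEdges t)
Move-reverse (S , T , inj₁ f) = IsSock-reverse S , IsSock-reverse T , inj₁ (Fwd-reverse f)
Move-reverse (S , T , inj₂ f) = IsSock-reverse S , IsSock-reverse T , inj₂ (Fwd-reverse f)

FlipTritHomotopic-reverse : ∀ {D s t} → FlipTritHomotopic D s t →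
                            FlipTritHomotopic D (reverseEdges s) (reverseEdges t)
FlipTritHomotopic-reverse ε = ε
FlipTritHomotopic-reverse (m ◅ ms) = Move-reverse m ◅ FlipTritHomotopic-reverse ms

-- Winding numbers

χ : ∀ {P : Set} → Dec P → ℤ
χ (yes _) = 1ℤ
χ (no _) = 0ℤ

χ-yes : ∀ {P : Set} → P → (p? : Dec P) → χ p? ≡ 1ℤ
χ-yes p (yes _) = refl
χ-yes p (no ¬p) = ⊥-elim (¬p p)

χ-no : ∀ {P : Set} → ¬ P → (p? : Dec P) → χ p? ≡ 0ℤ
χ-no ¬p (yes p) = ⊥-elim (¬p p)
χ-no ¬p (no _) = refl

χ-cong : ∀ {P Q : Set} → (P → Q) → (Q → P) → (p? : Dec P) (q? : Dec Q) → χ p? ≡ χ q?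
χ-cong P⇒Q Q⇒P (yes p) q? = sym (χ-yes (P⇒Q p) q?)
χ-cong P⇒Q Q⇒P (no ¬p) q? = sym (χ-no (λ q → ¬p (Q⇒P q)) q?)

∑ : ∀ {A : Set} → (A → ℤ) → List A → ℤ
∑ f xs = foldr _+_ 0ℤ (map f xs)

module _ {A : Set} where

  ∑-zero : ∀ (f : A → ℤ) xs → (∀ {x} → x ∈ xs → f x ≡ 0ℤ) → ∑ f xs ≡ 0ℤ
  ∑-zero f [] h = refl
  ∑-zero f (x ∷ xs) h = cong₂ _+_ (h (here refl)) (∑-zero f xs (λ m → h (there m)))

  ∑-cong : ∀ {f g : A → ℤ} xs → (∀ {x} → x ∈ xs → f x ≡ g x) → ∑ f xs ≡ ∑ g xs
  ∑-cong [] h = refl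
  ∑-cong (x ∷ xs) h = cong₂ _+_ (h (here refl)) (∑-cong xs (λ m → h (there m)))

  ∑-+ : ∀ (f g : A → ℤ) xs → ∑ (λ x → f x + g x) xs ≡ ∑ f xs + ∑ g xs
  ∑-+ f g [] = refl
  ∑-+ f g (x ∷ xs) rewrite ∑-+ f g xs = interchange (f x) (g x) (∑ f xs) (∑ g xs)
    where
    interchange : ∀ a b c d → (a + b) + (c + d) ≡ (a + c) + (b + d)
    interchange = solve-∀

  ∑-minus : ∀ (f g : A → ℤ) xs → ∑ (λ x → f x - g x) xs ≡ ∑ f xs - ∑ g xs
  ∑-minus f g [] = refl
  ∑-minus f g (x ∷ xs) rewrite ∑-minus f g xs = interchange (f x) (g x) (∑ f xs) (∑ g xs)
    where
    interchange : ∀ a b c d → (a - b) + (c - d) ≡ (a + c) - (b + d)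
    interchange = solve-∀

  ∑-map : ∀ {B : Set} (f : B → ℤ) (h : A → B) xs → ∑ f (map h xs) ≡ ∑ (λ x → f (h x)) xs
  ∑-map f h [] = refl
  ∑-map f h (x ∷ xs) = cong (λ i → f (h x) + i) (∑-map f h xs)

  ∑-↭ : ∀ (f : A → ℤ) {xs ys} → xs ↭ ys → ∑ f xs ≡ ∑ f ys
  ∑-↭ f p = ↭ₛ.foldr-commMonoid (setoid ℤ) ℤ.+-0-isCommutativeMonoid (↭⇒↭ₛ (↭-map⁺ f p))

  ∑-χ-≡-unique : (_≟_ : DecidableEquality A) → ∀ {a xs} → Unique xs → a ∈ xs →
                 ∑ (λ (x : A) → χ (x ≟ a)) xs ≡ 1ℤ
  ∑-χ-≡-unique _≟_ {a} {x ∷ xs} (x∉xs ∷ xs!) a∈ with x ≟ a | a∈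
  ... | yes refl | _ =
    cong (λ i → 1ℤ + i) (∑-zero _ xs (λ m → χ-no (λ { refl → All.lookup x∉xs m refl }) _))
  ... | no x≢a | here a≡x = ⊥-elim (x≢a (sym a≡x))
  ... | no _ | there a∈xs = trans (ℤ.+-identityˡ _) (∑-χ-≡-unique _≟_ xs! a∈xs)

  ∑-χ-≡-absent : (_≟_ : DecidableEquality A) → ∀ {a xs} → a ∉ xs →
                 ∑ (λ (x : A) → χ (x ≟ a)) xs ≡ 0ℤ
  ∑-χ-≡-absent _≟_ {a} {xs} a∉xs =
    ∑-zero (λ x → χ (x ≟ a)) xs (λ m → χ-no (λ { refl → a∉xs m }) _)

  Unique-map⁺ : ∀ {B : Set} (h : A → B) {xs} →
                (∀ {x y} → x ∈ xs → y ∈ xs → h x ≡ h y → x ≡ y) → Unique xs → Unique (map h xs)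
  Unique-map⁺ h {[]} _ _ = []
  Unique-map⁺ h {x ∷ xs} inj (x∉xs ∷ xs!) =
    All.tabulate hx≢ ∷ Unique-map⁺ h (λ a b → inj (there a) (there b)) xs!
    where
    hx≢ : ∀ {z} → z ∈ map h xs → h x ≢ z
    hx≢ m e with ∈-map⁻ h m
    ... | y , y∈xs , refl = All.lookup x∉xs y∈xs (inj (here refl) (there y∈xs) e)

  ∑-unique-sameElements : ∀ (f : A → ℤ) {xs ys} → Unique xs → Unique ys →
                          (∀ {z} → z ∈ xs → z ∈ ys) → (∀ {z} → z ∈ ys → z ∈ xs) →
                          ∑ f xs ≡ ∑ f ys
  ∑-unique-sameElements f xs! ys! xs⊆ys ys⊆xs =
    ∑-↭ f (∼bag⇒↭ (unique∧set⇒bag xs! ys! (mk⇔ xs⊆ys ys⊆xs)))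

crossingAt : ℤ → ℤ → Edge → ℤ
crossingAt c r e = χ (e ≟E ((c , r) , (c , sucℤ r))) - χ (e ≟E ((c , sucℤ r) , (c , r)))

crossing : ℤ → Edge → ℤ
crossing r e = crossingAt (proj₁ (proj₁ e)) r e

windingTerm : ℤ → ℤ → Edge → ℤ
windingTerm t r e = χ (t <? proj₁ (proj₁ e)) * crossing r e

private
  rows : ∀ {x y x' y' u v u' v' : ℤ} →
         ((x , y) , (x' , y')) ≡ ((u , v) , (u' , v')) → y ≡ v × y' ≡ v'
  rows refl = refl , refl


crossing-horizontal : ∀ x x' y r → crossing r ((x , y) , (x' , y)) ≡ 0ℤ
crossing-horizontal x x' y r
  rewrite χ-no (λ e → let (y≡r , y≡r+1) = rows e in suc[i]≢i (trans (sym y≡r+1) y≡r))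
                (((x , y) , (x' , y)) ≟E ((x , r) , (x , sucℤ r)))
        | χ-no (λ e → let (y≡r+1 , y≡r) = rows e in suc[i]≢i (trans (sym y≡r+1) y≡r))
                (((x , y) , (x' , y)) ≟E ((x , sucℤ r) , (x , r)))
  = refl

crossing-up : ∀ x y r → crossing r ((x , y) , (x , sucℤ y)) ≡ χ (y ℤ.≟ r)
crossing-up x y r
  rewrite χ-no (λ e → let (y≡r+1 , y+1≡r) = rows e
                      in suc[suc[i]]≢i (trans (cong sucℤ (sym y≡r+1)) y+1≡r))
                (((x , y) , (x , sucℤ y)) ≟E ((x , sucℤ r) , (x , r)))
  = trans (ℤ.+-identityʳ _)
          (χ-cong (λ e → proj₁ (rows e)) (λ { refl → refl })
                  (((x , y) , (x , sucℤ y)) ≟E ((x , r) , (x , sucℤ r))) (y ℤ.≟ r))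

crossing-down : ∀ x y r → crossing r ((x , y) , (x , pred y)) ≡ - χ (y ℤ.≟ sucℤ r)
crossing-down x y r
  rewrite χ-no (λ e → let (y≡r , y-1≡r+1) = rows e
                      in pred[i]≢suc[i] {r} (trans (cong pred (sym y≡r)) y-1≡r+1))
                (((x , y) , (x , pred y)) ≟E ((x , r) , (x , sucℤ r)))
  = trans (ℤ.+-identityˡ _)
          (cong -_ (χ-cong (λ e → proj₁ (rows e))
                           (λ { refl → cong (λ z → (x , sucℤ r) , (x , z)) (ℤ.pred-suc r) })
                           (((x , y) , (x , pred y)) ≟E ((x , sucℤ r) , (x , r))) (y ℤ.≟ sucℤ r)))

inRay : ℤ → ℤ → V → ℤ
inRay t r (x , y) = χ (y ℤ.≟ r) * χ (t <? x)

private
  inRay-right : ∀ {t r x y} → (x , y) ≢ (t , r) → inRay t r (sucℤ x , y) ≡ inRay t r (x , y)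
  inRay-right {t} {r} {x} {y} p≢ with y ℤ.≟ r
  ... | no _ = refl
  ... | yes refl =
    cong (1ℤ *_) (χ-cong (λ t<x+1 → ℤ.≤∧≢⇒< (i<suc[j]⇒i≤j t<x+1) (λ { refl → p≢ refl }))
                         (λ t<x → ℤ.<-trans t<x (i<suc[i] x)) (t <? sucℤ x) (t <? x))

  inRay-left : ∀ {t r x y} → (pred x , y) ≢ (t , r) → inRay t r (pred x , y) ≡ inRay t r (x , y)
  inRay-left {t} {r} {x} {y} p≢ with y ℤ.≟ r
  ... | no _ = refl
  ... | yes refl =
    cong (1ℤ *_) (χ-cong (λ t<x-1 → ℤ.<-trans t<x-1 (pred[i]<i x))
                         (λ t<x → ℤ.≤∧≢⇒< (ℤ.i<j⇒i≤pred[j] t<x) (λ { refl → p≢ refl }))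
                         (t <? pred x) (t <? x))

  χ-suc≟ : ∀ y r → χ (sucℤ y ℤ.≟ r) ≡ χ (y ℤ.≟ pred r)
  χ-suc≟ y r = χ-cong (λ { refl → sym (ℤ.pred-suc y) }) (λ { refl → ℤ.suc-pred r }) _ _

  χ-pred≟ : ∀ y r → χ (pred y ℤ.≟ r) ≡ χ (y ℤ.≟ sucℤ r)
  χ-pred≟ y r = χ-cong (λ { refl → sym (ℤ.suc-pred y) }) (λ { refl → ℤ.pred-suc r }) _ _

  χ-≟suc[pred] : ∀ y r → χ (y ℤ.≟ sucℤ (pred r)) ≡ χ (y ℤ.≟ r)
  χ-≟suc[pred] y r = cong (λ z → χ (y ℤ.≟ z)) (ℤ.suc-pred r)

  up-identity : ∀ X a b → a * X - b * X ≡ X * a - X * b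
  up-identity = solve-∀

  down-identity : ∀ X a b → a * X - b * X ≡ X * - b - X * - a
  down-identity = solve-∀


windingTerm-horizontal : ∀ t r x x' y → windingTerm t r ((x , y) , (x' , y)) ≡ 0ℤ
windingTerm-horizontal t r x x' y =
  trans (cong (χ (t <? x) *_) (crossing-horizontal x x' y r)) (ℤ.*-zeroʳ (χ (t <? x)))

private
  flux-horizontal : ∀ t r x x' y → inRay t r (x' , y) ≡ inRay t r (x , y) →
                    inRay t r (x' , y) - inRay t r (x , y)
                    ≡ windingTerm t (pred r) ((x , y) , (x' , y)) - windingTerm t r ((x , y) , (x' , y))
  flux-horizontal t r x x' y same = begin
    inRay t r (x' , y) - inRay t r (x , y) ≡⟨ cong (_- inRay t r (x , y)) same ⟩
    inRay t r (x , y) - inRay t r (x , y)  ≡⟨ ℤ.+-inverseʳ (inRay t r (x , y)) ⟩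
    0ℤ                                     ≡⟨ sym (cong₂ _-_ (windingTerm-horizontal t (pred r) x x' y)
                                                          (windingTerm-horizontal t r x x' y)) ⟩
    windingTerm t (pred r) ((x , y) , (x' , y)) - windingTerm t r ((x , y) , (x' , y)) ∎
    where open ≡-Reasoning

-- Moving along an edge that avoids (t , r) changes inRay exactly as the edge crosses the rays at
-- heights r - ½ and r + ½: this is the local form of winding-stepDown.
inRay-flux : ∀ t r {a b} → Adj a b → a ≢ (t , r) → b ≢ (t , r) →
             inRay t r b - inRay t r a ≡ windingTerm t (pred r) (a , b) - windingTerm t r (a , b)
inRay-flux t r {x , y} {b} adj a≢ b≢ with Adj⇒Neighbour {x , y} {b} adj
... | isRight refl = flux-horizontal t r x (sucℤ x) y (inRay-right a≢)
... | isLeft refl = flux-horizontal t r x (pred x) y (inRay-left b≢)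
... | isUp refl = begin
  χ (sucℤ y ℤ.≟ r) * X - χ (y ℤ.≟ r) * X
    ≡⟨ cong (λ z → z * X - χ (y ℤ.≟ r) * X) (χ-suc≟ y r) ⟩
  χ (y ℤ.≟ pred r) * X - χ (y ℤ.≟ r) * X
    ≡⟨ up-identity X (χ (y ℤ.≟ pred r)) (χ (y ℤ.≟ r)) ⟩
  X * χ (y ℤ.≟ pred r) - X * χ (y ℤ.≟ r)
    ≡⟨ sym (cong₂ (λ c c' → X * c - X * c') (crossing-up x y (pred r)) (crossing-up x y r)) ⟩
  X * crossing (pred r) ((x , y) , (x , sucℤ y)) - X * crossing r ((x , y) , (x , sucℤ y)) ∎
  where
  X : ℤ
  X = χ (t <? x)
  open ≡-Reasoning
... | isDown refl = begin
  χ (pred y ℤ.≟ r) * X - χ (y ℤ.≟ r) * X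
    ≡⟨ cong (λ z → z * X - χ (y ℤ.≟ r) * X) (χ-pred≟ y r) ⟩
  χ (y ℤ.≟ sucℤ r) * X - χ (y ℤ.≟ r) * X
    ≡⟨ down-identity X (χ (y ℤ.≟ sucℤ r)) (χ (y ℤ.≟ r)) ⟩
  X * - χ (y ℤ.≟ r) - X * - χ (y ℤ.≟ sucℤ r)
    ≡⟨ sym (cong₂ (λ c c' → X * c - X * c')
                  (trans (crossing-down x y (pred r)) (cong -_ (χ-≟suc[pred] y r)))
                  (crossing-down x y r)) ⟩
  X * crossing (pred r) ((x , y) , (x , pred y)) - X * crossing r ((x , y) , (x , pred y)) ∎
  where
  X : ℤ
  X = χ (t <? x)
  open ≡-Reasoning

private
  χ-pred[c]< : ∀ c x → χ (pred c <? x) ≡ χ (c <? x) + χ (x ℤ.≟ c)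
  χ-pred[c]< c x with pred c <? x | c <? x | x ℤ.≟ c
  ... | _ | yes c<x | yes refl = ⊥-elim (ℤ.<-irrefl refl c<x)
  ... | yes _ | yes _ | no _ = refl
  ... | yes _ | no _ | yes _ = refl
  ... | yes c-1<x | no c≮x | no x≢c =
    ⊥-elim (x≢c (ℤ.≤-antisym (ℤ.≮⇒≥ c≮x)
                             (subst (_≤ x) (ℤ.suc-pred c) (ℤ.i<j⇒suc[i]≤j c-1<x))))
  ... | no c-1≮x | yes c<x | _ = ⊥-elim (c-1≮x (ℤ.<-trans (pred[i]<i c) c<x))
  ... | no c-1≮x | no _ | yes refl = ⊥-elim (c-1≮x (pred[i]<i c))
  ... | no _ | no _ | no _ = refl

  crossingAt-column : ∀ c r e → χ (proj₁ (proj₁ e) ℤ.≟ c) * crossing r e ≡ crossingAt c r e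
  crossingAt-column c r e@((x , y) , b) = by-cases (x ℤ.≟ c)
    where
    by-cases : (x≟c : Dec (x ≡ c)) → χ x≟c * crossing r e ≡ crossingAt c r e
    by-cases (yes refl) = ℤ.*-identityˡ (crossing r e)
    by-cases (no x≢c) = sym (cong₂ _-_ (χ-no (x≢c ∘ ,-injectiveˡ ∘ ,-injectiveˡ) (e ≟E _))
                                      (χ-no (x≢c ∘ ,-injectiveˡ ∘ ,-injectiveˡ) (e ≟E _)))

windingTerm-stepLeft : ∀ c r e → windingTerm (pred c) r e ≡ windingTerm c r e + crossingAt c r e
windingTerm-stepLeft c r e = begin
  χ (pred c <? x) * crossing r e
    ≡⟨ cong (_* crossing r e) (χ-pred[c]< c x) ⟩
  (χ (c <? x) + χ (x ℤ.≟ c)) * crossing r e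
    ≡⟨ ℤ.*-distribʳ-+ (crossing r e) (χ (c <? x)) _ ⟩
  χ (c <? x) * crossing r e + χ (x ℤ.≟ c) * crossing r e
    ≡⟨ cong (λ i → windingTerm c r e + i) (crossingAt-column c r e) ⟩
  windingTerm c r e + crossingAt c r e ∎
  where
  x : ℤ
  x = proj₁ (proj₁ e)
  open ≡-Reasoning

-- winding t r is the winding number of the sock around the point (t + ½ , r + ½), counted as the
-- signed number of crossings of the ray going right from that point.
module Winding {D : Region} {s : Sock} (S : IsSock D s) where
  open IsSock S
  open SockProperties S

  edgeSet : List Edge
  edgeSet = deduplicate _≟E_ s

  edgeSet! : Unique edgeSet
  edgeSet! = Unique.deduplicate-! _≟E_ s

  edgeSet⁻ : ∀ {e} → e ∈ edgeSet → e ∈ s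
  edgeSet⁻ = ∈-deduplicate⁻ _≟E_ s

  edgeSet⁺ : ∀ {e} → e ∈ s → e ∈ edgeSet
  edgeSet⁺ = ∈-deduplicate⁺ _≟E_

  winding : ℤ → ℤ → ℤ
  winding t r = ∑ (windingTerm t r) edgeSet

  columnCrossing : ℤ → ℤ → ℤ
  columnCrossing c r = ∑ (crossingAt c r) edgeSet

  winding-stepLeft : ∀ c r → winding (pred c) r ≡ winding c r + columnCrossing c r
  winding-stepLeft c r = trans (∑-cong edgeSet (λ {e} _ → windingTerm-stepLeft c r e)) (∑-+ _ _ edgeSet)

  private
    ∑crossingAt : ∀ c r → columnCrossing c r
                  ≡ ∑ (λ e → χ (e ≟E ((c , r) , (c , sucℤ r)))) edgeSet
                    - ∑ (λ e → χ (e ≟E ((c , sucℤ r) , (c , r)))) edgeSet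
    ∑crossingAt c r = ∑-minus _ _ edgeSet

  columnCrossing-off : ∀ c r → ¬ OnSock s (c , r) ⊎ ¬ OnSock s (c , sucℤ r) → columnCrossing c r ≡ 0ℤ
  columnCrossing-off c r off = trans (∑crossingAt c r)
    (cong₂ _-_
      (∑-χ-≡-absent _≟E_ (λ m → ¬both off (_ , inj₁ (edgeSet⁻ m)) (_ , inj₂ (edgeSet⁻ m))))
      (∑-χ-≡-absent _≟E_ (λ m → ¬both off (_ , inj₂ (edgeSet⁻ m)) (_ , inj₁ (edgeSet⁻ m)))))
    where
    ¬both : ∀ {P Q : Set} → ¬ P ⊎ ¬ Q → P → Q → ⊥
    ¬both (inj₁ ¬p) p _ = ¬p p
    ¬both (inj₂ ¬q) _ q = ¬q q

  columnCrossing-down : ∀ c r → ((c , sucℤ r) , (c , r)) ∈ s → columnCrossing c r ≡ -1ℤ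
  columnCrossing-down c r down∈s = trans (∑crossingAt c r)
    (cong₂ _-_ (∑-χ-≡-absent _≟E_ (λ m → noBack down∈s (edgeSet⁻ m)))
               (∑-χ-≡-unique _≟E_ edgeSet! (edgeSet⁺ down∈s)))

  winding-left-of-down : ∀ c r → ((c , sucℤ r) , (c , r)) ∈ s → winding (pred c) r ≡ winding c r - 1ℤ
  winding-left-of-down c r down∈s =
    trans (winding-stepLeft c r) (cong (λ i → winding c r + i) (columnCrossing-down c r down∈s))

  winding-stepDown : ∀ t r → ¬ OnSock s (t , r) → winding t (pred r) ≡ winding t r
  winding-stepDown t r off = ℤ.i-j≡0⇒i≡j _ _ (begin
    winding t (pred r) - winding t r
      ≡⟨ sym (∑-minus _ _ edgeSet) ⟩
    ∑ (λ e → windingTerm t (pred r) e - windingTerm t r e) edgeSet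
      ≡⟨ sym (∑-cong edgeSet flux) ⟩
    ∑ (λ e → inRay t r (proj₂ e) - inRay t r (proj₁ e)) edgeSet
      ≡⟨ ∑-minus _ _ edgeSet ⟩
    ∑ (inRay t r ∘ proj₂) edgeSet - ∑ (inRay t r ∘ proj₁) edgeSet
      ≡⟨ cong₂ _-_ (sym (∑-map (inRay t r) proj₂ edgeSet)) (sym (∑-map (inRay t r) proj₁ edgeSet)) ⟩
    ∑ (inRay t r) targets - ∑ (inRay t r) sources
      ≡⟨ cong (_- ∑ (inRay t r) sources)
              (∑-unique-sameElements (inRay t r) targets! sources! target⇒source source⇒target) ⟩
    ∑ (inRay t r) sources - ∑ (inRay t r) sources
      ≡⟨ ℤ.+-inverseʳ (∑ (inRay t r) sources) ⟩
    0ℤ ∎)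
    where
    open ≡-Reasoning
    sources targets : List V
    sources = map proj₁ edgeSet
    targets = map proj₂ edgeSet
    flux : ∀ {e} → e ∈ edgeSet → inRay t r (proj₂ e) - inRay t r (proj₁ e)
                                 ≡ windingTerm t (pred r) e - windingTerm t r e
    flux m = inRay-flux t r (edge-Adj (edgeSet⁻ m))
               (λ { refl → off (_ , inj₁ (edgeSet⁻ m)) }) (λ { refl → off (_ , inj₂ (edgeSet⁻ m)) })
    sources! : Unique sources
    sources! = Unique-map⁺ proj₁
      (λ { {a , b} {.a , b'} m m' refl → cong (a ,_) (outUniq (edgeSet⁻ m) (edgeSet⁻ m')) }) edgeSet!
    targets! : Unique targets
    targets! = Unique-map⁺ proj₂
      (λ { {a , b} {a' , .b} m m' refl → cong (_, b) (inUniq (edgeSet⁻ m) (edgeSet⁻ m')) }) edgeSet!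
    target⇒source : ∀ {z} → z ∈ targets → z ∈ sources
    target⇒source m with ∈-map⁻ proj₂ m
    ... | _ , ab∈ , refl = ∈-map⁺ proj₁ (edgeSet⁺ (proj₂ (next (edgeSet⁻ ab∈))))
    source⇒target : ∀ {z} → z ∈ sources → z ∈ targets
    source⇒target m with ∈-map⁻ proj₁ m
    ... | _ , ab∈ , refl = ∈-map⁺ proj₂ (edgeSet⁺ (proj₂ (prev (edgeSet⁻ ab∈))))

  winding-beyond : ∀ t r → (∀ {a b} → (a , b) ∈ s → proj₁ a ≤ t) → winding t r ≡ 0ℤ
  winding-beyond t r s≤t = ∑-zero _ edgeSet λ {e} m →
    cong (_* crossing r e) (χ-no (ℤ.≤⇒≯ (s≤t (edgeSet⁻ m))) (t <? proj₁ (proj₁ e)))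

  WindingVanishesAround : V → Set
  WindingVanishesAround (x , y) =
    winding (pred x) (pred y) ≡ 0ℤ × winding x (pred y) ≡ 0ℤ ×
    winding (pred x) y ≡ 0ℤ × winding x y ≡ 0ℤ

  winding-stepLeft-off : ∀ c r → ¬ OnSock s (c , r) ⊎ ¬ OnSock s (c , sucℤ r) →
                         winding (pred c) r ≡ winding c r
  winding-stepLeft-off c r off =
    trans (winding-stepLeft c r)
          (trans (cong (λ i → winding c r + i) (columnCrossing-off c r off)) (ℤ.+-identityʳ _))

  vanishesAround : ∀ x y → ¬ OnSock s (x , y) → winding x y ≡ 0ℤ → WindingVanishesAround (x , y)
  vanishesAround x y off w≡0 =
    trans (winding-stepLeft-off x (pred y) (inj₂ off′)) below , below ,
    trans (winding-stepLeft-off x y (inj₁ off)) w≡0 , w≡0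
    where
    below : winding x (pred y) ≡ 0ℤ
    below = trans (winding-stepDown x y off) w≡0
    off′ : ¬ OnSock s (x , sucℤ (pred y))
    off′ = subst (λ z → ¬ OnSock s (x , z)) (sym (ℤ.suc-pred y)) off

  vanishesAround-outside : ∀ {a b} → a ∉ D → Adj a b → WindingVanishesAround b → WindingVanishesAround a
  vanishesAround-outside {x , y} {b} a∉D adj (_ , w₂ , w₃ , w₄) =
    vanishesAround x y off (shared (Adj⇒Neighbour {x , y} {b} adj))
    where
    off : ¬ OnSock s (x , y)
    off = ¬OnSock-outside a∉D
    shared : Neighbour (x , y) b → winding x y ≡ 0ℤ
    shared (isRight refl) = subst (λ z → winding z y ≡ 0ℤ) (ℤ.pred-suc x) w₃
    shared (isLeft refl) = trans (sym (winding-stepLeft-off x y (inj₁ off))) w₄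
    shared (isUp refl) = subst (λ z → winding x z ≡ 0ℤ) (ℤ.pred-suc y) w₂
    shared (isDown refl) = trans (sym (winding-stepDown x y off)) w₄

  -- Simple connectivity enters here: every cell outside D reaches the unbounded region, where the
  -- winding number vanishes, through cells outside D.
  winding-outside : ComplementConnected D → ∀ {x y} → (x , y) ∉ D → winding x y ≡ 0ℤ
  winding-outside cc {x} {y} p∉D with cc (x , y) p∉D
  ... | (cx , cy) , D<cx , path = proj₂ (proj₂ (proj₂ (along path far)))
    where
    s≤cx : ∀ {a b} → (a , b) ∈ s → proj₁ a ≤ cx
    s≤cx ab = ℤ.<⇒≤ (D<cx _ (source∈D ab))
    s≤cx-1 : ∀ {a b} → (a , b) ∈ s → proj₁ a ≤ pred cx
    s≤cx-1 ab = ℤ.i<j⇒i≤pred[j] (D<cx _ (source∈D ab))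
    far : WindingVanishesAround (cx , cy)
    far = winding-beyond _ _ s≤cx-1 , winding-beyond _ _ s≤cx ,
          winding-beyond _ _ s≤cx-1 , winding-beyond _ _ s≤cx
    along : ∀ {a b} → Star (λ a b → a ∉ D × b ∉ D × Adj a b) a b →
            WindingVanishesAround b → WindingVanishesAround a
    along ε vb = vb
    along ((a∉D , _ , adj) ◅ path) vb = vanishesAround-outside a∉D adj (along path vb)

-- The measure

module ℤExtrema = Data.List.Extrema ℤ.≤-totalOrder

sumℕ : ∀ {A : Set} → (A → ℕ) → List A → ℕ
sumℕ f [] = 0
sumℕ f (x ∷ xs) = f x ℕ.+ sumℕ f xs

module _ {A : Set} where

  sumℕ-mono : ∀ {f g : A → ℕ} xs → (∀ x → f x ℕ.≤ g x) → sumℕ f xs ℕ.≤ sumℕ g xs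
  sumℕ-mono [] f≤g = z≤n
  sumℕ-mono (x ∷ xs) f≤g = ℕ.+-mono-≤ (f≤g x) (sumℕ-mono xs f≤g)

  sumℕ-strictMono : ∀ {f g : A → ℕ} {xs a} → (∀ x → f x ℕ.≤ g x) → a ∈ xs → f a ℕ.< g a →
                    sumℕ f xs ℕ.< sumℕ g xs
  sumℕ-strictMono {xs = x ∷ xs} f≤g (here refl) fa<ga = ℕ.+-mono-<-≤ fa<ga (sumℕ-mono xs f≤g)
  sumℕ-strictMono {xs = x ∷ xs} f≤g (there a∈xs) fa<ga =
    ℕ.+-mono-≤-< (f≤g x) (sumℕ-strictMono f≤g a∈xs fa<ga)

except : V → (V → ℕ) → V → ℕ
except a f d with d ≟V a
... | yes _ = 0
... | no _ = f d

sumℕ-pick : ∀ f {xs a} → Unique xs → a ∈ xs → sumℕ f xs ≡ f a ℕ.+ sumℕ (except a f) xs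
sumℕ-pick f {x ∷ xs} {a} (x∉xs ∷ xs!) a∈ with x ≟V a | a∈
... | yes refl | _ =
  cong (f x ℕ.+_) (sym (sumℕ-cong xs (λ d∈xs → except-≢ (λ { refl → All.lookup x∉xs d∈xs refl }))))
  where
  except-≢ : ∀ {d} → d ≢ x → except x f d ≡ f d
  except-≢ {d} d≢x with d ≟V x
  ... | yes d≡x = ⊥-elim (d≢x d≡x)
  ... | no _ = refl
  sumℕ-cong : ∀ {g h : V → ℕ} ys → (∀ {d} → d ∈ ys → g d ≡ h d) → sumℕ g ys ≡ sumℕ h ys
  sumℕ-cong [] _ = refl
  sumℕ-cong (y ∷ ys) g≡h = cong₂ ℕ._+_ (g≡h (here refl)) (sumℕ-cong ys (λ m → g≡h (there m)))
... | no x≢a | here a≡x = ⊥-elim (x≢a (sym a≡x))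
... | no _ | there a∈xs rewrite sumℕ-pick f xs! a∈xs = x∙yz≈y∙xz (f x) (f a) _

diagonal : V → ℤ
diagonal (x , y) = x + y

-- The 0ℤ is only the default value of min: any lower bound of diagonal on D would do as base.
module Measure (D : Region) where

  cells : List V
  cells = deduplicate _≟V_ D

  base : ℤ
  base = ℤExtrema.min 0ℤ (map diagonal D)

  base≤diagonal : ∀ {d} → d ∈ D → base ≤ diagonal d
  base≤diagonal d∈D = All.lookup (ℤExtrema.min≤xs 0ℤ (map diagonal D)) (∈-map⁺ diagonal d∈D)

  height : V → ℕ
  height d = ∣ diagonal d - base ∣

  height-< : ∀ {p c} → p ∈ D → diagonal p < diagonal c → height p ℕ.< height c
  height-< {p} {c} p∈D p<c = ℤ.drop‿+<+ (begin-strict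
    + height p       ≡⟨ ℤ.0≤i⇒+∣i∣≡i (ℤ.i≤j⇒0≤j-i b≤p) ⟩
    diagonal p - base <⟨ ℤ.+-monoˡ-< (- base) p<c ⟩
    diagonal c - base ≡⟨ ℤ.0≤i⇒+∣i∣≡i (ℤ.i≤j⇒0≤j-i (ℤ.≤-trans b≤p (ℤ.<⇒≤ p<c))) ⟨
    + height c        ∎)
    where
    open ℤ.≤-Reasoning
    b≤p : base ≤ diagonal p
    b≤p = base≤diagonal p∈D

  weight : Sock → V → ℕ
  weight s d with onSock? s d
  ... | yes _ = suc (height d)
  ... | no _ = 0

  μ : Sock → ℕ
  μ s = sumℕ (weight s) cells

  weight-off : ∀ {s d} → ¬ OnSock s d → weight s d ≡ 0
  weight-off {s} {d} off with onSock? s d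
  ... | yes on = ⊥-elim (off on)
  ... | no _ = refl

  weight-mono : ∀ {s t} d → (OnSock t d → OnSock s d) → weight t d ℕ.≤ weight s d
  weight-mono {s} {t} d t⇒s with onSock? t d | onSock? s d
  ... | yes _ | yes _ = ℕ.≤-refl
  ... | yes on | no off = ⊥-elim (off (t⇒s on))
  ... | no _ | _ = z≤n

  μ-mono : ∀ {s t} → (∀ d → OnSock t d → OnSock s d) → μ t ℕ.≤ μ s
  μ-mono t⇒s = sumℕ-mono cells (λ d → weight-mono d (t⇒s d))

  μ-<-drop : ∀ {s t d} → (∀ d → OnSock t d → OnSock s d) → d ∈ D → OnSock s d → ¬ OnSock t d →
             μ t ℕ.< μ s
  μ-<-drop {s} {t} {d} t⇒s d∈D on off =
    sumℕ-strictMono (λ d → weight-mono d (t⇒s d)) (∈-deduplicate⁺ _≟V_ d∈D) weight-drops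
    where
    weight-drops : weight t d ℕ.< weight s d
    weight-drops with onSock? t d | onSock? s d
    ... | yes on' | _ = ⊥-elim (off on')
    ... | no _ | yes _ = s≤s z≤n
    ... | no _ | no off' = ⊥-elim (off' on)

  μ-<-trade : ∀ {s t c p} → c ∈ D → p ∈ D → OnSock s c → ¬ OnSock t c → OnSock t p →
              diagonal p < diagonal c → (∀ d → d ≢ p → OnSock t d → OnSock s d) → μ t ℕ.< μ s
  μ-<-trade {s} {t} {c} {p} c∈D p∈D on-c off-c on-p p<c t⇒s = begin-strict
    μ t                                  ≡⟨ sumℕ-pick (weight t) cells! (∈-deduplicate⁺ _≟V_ p∈D) ⟩
    weight t p ℕ.+ sumℕ (except p (weight t)) cells
                                         <⟨ ℕ.+-mono-<-≤ p-below-c (sumℕ-mono cells rest) ⟩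
    weight s c ℕ.+ sumℕ (except c (weight s)) cells
                                         ≡⟨ sumℕ-pick (weight s) cells! (∈-deduplicate⁺ _≟V_ c∈D) ⟨
    μ s                                  ∎
    where
    open ℕ.≤-Reasoning
    cells! : Unique cells
    cells! = Unique.deduplicate-! _≟V_ D
    p-below-c : weight t p ℕ.< weight s c
    p-below-c with onSock? t p | onSock? s c
    ... | yes _ | yes _ = s≤s (height-< {c = c} p∈D p<c)
    ... | no off | _ = ⊥-elim (off on-p)
    ... | _ | no off = ⊥-elim (off on-c)
    rest : ∀ d → except p (weight t) d ℕ.≤ except c (weight s) d
    rest d with d ≟V p | d ≟V c
    ... | yes _ | _ = z≤n
    ... | no _ | yes refl = ℕ.≤-reflexive (weight-off off-c)
    ... | no d≢p | no _ = weight-mono d (t⇒s d d≢p)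

-- Descent

Progress : Region → Sock → Set
Progress D s = ∃ λ t → FlipTritHomotopic D s t × IsSock D t × Measure.μ D t ℕ.< Measure.μ D s

module _ {D : Region} where
  open Measure D

  μ-reverse : ∀ s → μ (reverseEdges s) ≡ μ s
  μ-reverse s = ℕ.≤-antisym (μ-mono (λ _ → OnSock-reverse⁻)) (μ-mono (λ _ → OnSock-reverse⁺))

  Progress-reverse : ∀ {s} → Progress D (reverseEdges s) → Progress D s
  Progress-reverse {s} (t , s↝t , T , t<s) =
    reverseEdges t ,
    subst (λ s' → FlipTritHomotopic D s' (reverseEdges t)) (reverseEdges-involutive s)
          (FlipTritHomotopic-reverse s↝t) ,
    IsSock-reverse T ,
    subst₂ ℕ._<_ (sym (μ-reverse t)) (μ-reverse s) t<s

  Progress-prepend : ∀ {s s₁} → Move D s s₁ → μ s₁ ℕ.≤ μ s → Progress D s₁ → Progress D s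
  Progress-prepend m s₁≤s (t , s₁↝t , T , t<s₁) = t , m ◅ s₁↝t , T , ℕ.<-≤-trans t<s₁ s₁≤s

module LocalProgress {D : Region} {s : Sock} (S : IsSock D s) where
  open Measure D
  open SockProperties S

  trit-progress : ∀ {u v w j} → (u , v) ∈ s → (v , w) ∈ s → Jewel D s j → Square u v w j →
                  diagonal j < diagonal v → Progress D s
  trit-progress {u} {v} {w} {j} uv vw J Q j<v =
    t , (S , T.isSock , inj₁ (trit uv vw J Q R)) ◅ ε , T.isSock ,
    μ-<-trade (target∈D uv) (proj₁ J) (w , inj₁ vw) T.v-off T.j-on j<v (λ d d≢j → T.onSock-reflect d d≢j)
    where
    t : Sock
    t = replace s ((u , v) ∷ (v , w) ∷ []) ((u , j) ∷ (j , w) ∷ [])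
    R : Replace s ((u , v) ∷ (v , w) ∷ []) ((u , j) ∷ (j , w) ∷ []) t
    R = replace-correct s _ _
    module T = TritMove S uv vw J Q R

  shortcut-progress : ∀ {u a b v} → (u , a) ∈ s → (a , b) ∈ s → (b , v) ∈ s → Square u v b a →
                      (v , u) ∉ s → Progress D s
  shortcut-progress {u} {a} {b} {v} ua ab bv Q vu∉s =
    t , (S , T.isSock , inj₂ T.move) ◅ ε , T.isSock ,
    μ-<-drop T.onSock-reflect (proj₁ T.a-jewel) (b , inj₁ ab) (proj₂ T.a-jewel)
    where
    t : Sock
    t = replace s ((u , a) ∷ (a , b) ∷ (b , v) ∷ []) ((u , v) ∷ [])
    module T = ShortcutMove S ua ab bv Q vu∉s (replace-correct s _ _)

  removeSquare-progress : ∀ {a b c d} → (a , b) ∈ s → (b , c) ∈ s → (c , d) ∈ s → (d , a) ∈ s →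
                          Square a b c d → Progress D s
  removeSquare-progress {a} {b} {c} {d} ab bc cd da Q =
    t , (S , T.isSock , inj₂ T.move) ◅ ε , T.isSock ,
    μ-<-drop T.onSock-reflect (proj₁ T.a-jewel) (b , inj₁ ab) (proj₂ T.a-jewel)
    where
    t : Sock
    t = replace s ((a , b) ∷ (b , c) ∷ (c , d) ∷ (d , a) ∷ []) []
    module T = SquareRemoval S ab bc cd da Q (replace-correct s _ _)

private
  pred[b+suc[k]] : ∀ b k → pred (b + + suc k) ≡ b + + k
  pred[b+suc[k]] b k = lemma b (+ k)
    where
    lemma : ∀ b k → -1ℤ + (b + (1ℤ + k)) ≡ b + k
    lemma = solve-∀

  b+[a-b] : ∀ a b → b + (a - b) ≡ a
  b+[a-b] = solve-∀

≤-pred-fuel : ∀ {y b k} → y ≤ b + + suc k → pred y ≤ b + + k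
≤-pred-fuel {y} {b} {k} h = subst (pred y ≤_) (pred[b+suc[k]] b k) (ℤ.pred-mono h)

≤-initial-fuel : ∀ {a b} → b ≤ a → a ≤ b + + ∣ a - b ∣
≤-initial-fuel {a} {b} b≤a =
  ℤ.≤-reflexive (sym (trans (cong (λ i → b + i) (ℤ.0≤i⇒+∣i∣≡i (ℤ.i≤j⇒0≤j-i b≤a)))
                            (b+[a-b] a b)))

<⇒≡pred⊎<pred : ∀ {a b} → a < b → a ≡ pred b ⊎ a < pred b
<⇒≡pred⊎<pred {a} {b} a<b with a ℤ.≟ pred b
... | yes a≡ = inj₁ a≡
... | no a≢ = inj₂ (ℤ.≤∧≢⇒< (ℤ.i<j⇒i≤pred[j] a<b) a≢)

≤∧≢pred⇒≤ : ∀ {a b} → pred a ≤ b → b ≢ pred a → a ≤ b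
≤∧≢pred⇒≤ {a} {b} a-1≤b b≢ =
  subst (_≤ b) (ℤ.suc-pred a) (ℤ.i<j⇒suc[i]≤j (ℤ.≤∧≢⇒< a-1≤b (λ e → b≢ (sym e))))

module Descent {D : Region} (cc : ComplementConnected D) {s : Sock} (S : IsSock D s) where
  open IsSock S
  open SockProperties S
  open Winding S
  open Measure D
  open LocalProgress S

  Run : ℤ → ℤ → ℤ → Set
  Run x bottom top = ∀ {y} → bottom ≤ y → y < top → ((x , sucℤ y) , (x , y)) ∈ s

  Run-empty : ∀ {x y} → Run x y y
  Run-empty y≤y' y'<y = ⊥-elim (ℤ.<⇒≱ y'<y y≤y')

  Run-extend : ∀ {x y top} → Run x y top → ((x , y) , (x , pred y)) ∈ s → Run x (pred y) top
  Run-extend {x} {y} run e {y'} y-1≤y' y'<top with y' ℤ.≟ pred y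
  ... | yes refl = subst (λ z → ((x , z) , (x , pred y)) ∈ s) (sym (ℤ.suc-pred y)) e
  ... | no y'≢ = run (≤∧≢pred⇒≤ y-1≤y' y'≢) y'<top

  record LeftTurn (x yb top : ℤ) : Set where
    field
      row : ℤ
      yb<row : yb < row
      row<top : row < top
      run : Run x row top
      turn : ((x , row) , (pred x , row)) ∈ s

  descend : ∀ k {x yb top y} → y ≤ yb + + k → yb < y → y < top → Run x y top →
            (∀ {y'} → yb < y' → y' < top → ((x , y') , (sucℤ x , y')) ∉ s) →
            ((x , sucℤ yb) , (x , yb)) ∉ s → LeftTurn x yb top
  descend zero fuel yb<y _ _ _ _ = ⊥-elim (ℤ.<⇒≱ yb<y (subst (_ ≤_) (ℤ.+-identityʳ _) fuel))
  descend (suc k) {x} {yb} {top} {y} fuel yb<y y<top run noRight stop with next (run ℤ.≤-refl y<top)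
  ... | z , out with Adj⇒Neighbour {x , y} {z} (edge-Adj out)
  ... | isRight refl = ⊥-elim (noRight yb<y y<top out)
  ... | isUp refl = ⊥-elim (noBack (run ℤ.≤-refl y<top) out)
  ... | isLeft refl = record { row = y ; yb<row = yb<y ; row<top = y<top ; run = run ; turn = out }
  ... | isDown refl with <⇒≡pred⊎<pred yb<y
  ...   | inj₁ refl = ⊥-elim (stop (subst (λ z → ((x , z) , (x , pred y)) ∈ s) (sym (ℤ.suc-pred y)) out))
  ...   | inj₂ yb<y-1 =
    descend k (≤-pred-fuel {b = yb} {k = k} fuel) yb<y-1 (ℤ.<-trans (pred[i]<i y) y<top)
              (Run-extend run out) noRight stop

  -- winding≤0 is the invariant that forces the cell diagonally below-left of (c , y1) into D.
  record Bracket (c y0 y1 : ℤ) : Set where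
    field
      y0<y1 : y0 < y1
      top : ((pred c , y1) , (c , y1)) ∈ s
      run : Run c y0 y1
      bottom : ((c , y0) , (pred c , y0)) ∈ s
      winding≤0 : ∀ {r} → y0 ≤ r → r < y1 → winding c r ≤ 0ℤ

    first : ((c , y1) , (c , pred y1)) ∈ s
    first = subst (λ z → ((c , z) , (c , pred y1)) ∈ s) (ℤ.suc-pred y1)
                  (run (ℤ.i<j⇒i≤pred[j] y0<y1) (pred[i]<i y1))

    winding-left<0 : ∀ {r} → y0 ≤ r → r < y1 → winding (pred c) r < 0ℤ
    winding-left<0 {r} y0≤r r<y1 = begin-strict
      winding (pred c) r   ≡⟨ winding-left-of-down c r (run y0≤r r<y1) ⟩
      winding c r - 1ℤ     ≡⟨ ℤ.+-comm (winding c r) -1ℤ ⟩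
      pred (winding c r)   <⟨ ℤ.<-≤-trans (pred[i]<i _) (winding≤0 y0≤r r<y1) ⟩
      0ℤ                   ∎
      where open ℤ.≤-Reasoning

  closeBracket : ∀ {c y1} → Bracket c (pred y1) y1 → Progress D s
  closeBracket {c} {y1} B with (downLeft (c , y1) , left (c , y1)) ∈E? s
  ... | yes back = removeSquare-progress top first bottom back
                     (Square-rotate (Square-rotate (Square-rotate (Square-downLeft (c , y1)))))
    where open Bracket B
  ... | no back∉s = shortcut-progress top first bottom (Square-reverse (Square-downLeft (c , y1))) back∉s
    where open Bracket B

  Scan : ℕ → Set
  Scan n = ∀ {c y0 y1} → y1 ≤ y0 + + n → Bracket c y0 y1 → Progress D s

  module Corner {c y0 y1} (B : Bracket c y0 y1) (y0<y1-1 : y0 < pred y1) where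
    open Bracket B

    p q : V
    p = (c , y1)
    q = downLeft p

    second : (down p , down (down p)) ∈ s
    second = subst (λ z → ((c , z) , (c , pred (pred y1))) ∈ s) (ℤ.suc-pred (pred y1))
                   (run (ℤ.i<j⇒i≤pred[j] y0<y1-1) (ℤ.<-trans (pred[i]<i (pred y1)) (pred[i]<i y1)))

    q∈D : q ∈ D
    q∈D with DecMembership._∈?_ _≟V_ q D
    ... | yes q∈D = q∈D
    ... | no q∉D =
      ⊥-elim (ℤ.<⇒≢ (winding-left<0 (ℤ.<⇒≤ y0<y1-1) (pred[i]<i y1)) (winding-outside cc q∉D))

    data Exit : Set where
      toUp   : (q , left p) ∈ s → Exit
      toLeft : (q , left q) ∈ s → Exit
      toDown : (q , down q) ∈ s → Exit

    data Entry : Set where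
      fromLeft : (left q , q) ∈ s → Entry
      fromDown : (down q , q) ∈ s → Entry

    exit : OnSock s q → Exit
    exit on with outEdge on
    ... | z , h with Adj⇒Neighbour {q} {z} (edge-Adj h)
    ... | isRight refl =
      ⊥-elim (pred[i]≢i (cong proj₁
        (inUniq (subst (λ a → (q , (a , pred y1)) ∈ s) (ℤ.suc-pred c) h) first)))
    ... | isUp refl = toUp (subst (λ a → (q , (pred c , a)) ∈ s) (ℤ.suc-pred y1) h)
    ... | isLeft refl = toLeft h
    ... | isDown refl = toDown h

    entry : OnSock s q → Entry
    entry on with inEdge on
    ... | z , h with Adj⇒Neighbour {q} {z} (Adj-sym z q (edge-Adj h))
    ... | isRight refl =
      ⊥-elim (pred[i]≢i (cong proj₁
        (outUniq (subst (λ a → ((a , pred y1) , q) ∈ s) (ℤ.suc-pred c) h) second)))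
    ... | isUp refl =
      ⊥-elim (i≢pred[i] (cong proj₂
        (outUniq top (subst (λ a → ((pred c , a) , q) ∈ s) (ℤ.suc-pred y1) h))))
    ... | isLeft refl = fromLeft h
    ... | isDown refl = fromDown h

    trit-corner : ¬ OnSock s q → Progress D s
    trit-corner off = trit-progress top first (q∈D , off)
                        (Square-rotate (Square-rotate (Square-rotate (Square-downLeft p))))
                        (ℤ.+-mono-< (pred[i]<i c) (pred[i]<i y1))

    shortcut-corner : (q , left p) ∈ s → Progress D s
    shortcut-corner qP = shortcut-progress qP top first (Square-rotate (Square-reverse (Square-downLeft p)))
                                           (λ h → pred[i]≢i (cong proj₁ (outUniq h second)))

    nested : ∀ {n} → Scan n → pred y1 ≤ y0 + + n → (left q , q) ∈ s → (q , down q) ∈ s → Progress D s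
    nested {n} scan fuel Lq qd = scan (ℤ.≤-trans fuel (ℤ.+-monoˡ-≤ (+ n) (ℤ.<⇒≤ T.yb<row))) inner
      where
      y0<y1-2 : y0 < pred (pred y1)
      y0<y1-2 with <⇒≡pred⊎<pred y0<y1-1
      ... | inj₁ y0≡ =
        ⊥-elim (pred[i]≢i (cong proj₁ (inUniq qd (subst (λ z → ((c , z) , (pred c , z)) ∈ s) y0≡ bottom))))
      ... | inj₂ y0< = y0<
      noRight : ∀ {y'} → y0 < y' → y' < pred y1 → ((pred c , y') , (sucℤ (pred c) , y')) ∉ s
      noRight {y'} y0<y' y'<y1-1 h =
        pred[i]≢i (cong proj₁ (inUniq (subst (λ a → ((pred c , y') , (a , y')) ∈ s) (ℤ.suc-pred c) h)
                                  (run (ℤ.<⇒≤ y0<y') (ℤ.<-trans y'<y1-1 (pred[i]<i y1)))))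
      T : LeftTurn (pred c) y0 (pred y1)
      T = descend n (ℤ.≤-trans (ℤ.<⇒≤ (pred[i]<i (pred y1))) fuel) y0<y1-2 (pred[i]<i (pred y1))
                  (Run-extend Run-empty qd) noRight (λ h → pred[i]≢i (cong proj₁ (inUniq h bottom)))
      module T = LeftTurn T
      inner : Bracket (pred c) T.row (pred y1)
      inner = record
        { y0<y1 = T.row<top ; top = Lq ; run = T.run ; bottom = T.turn
        ; winding≤0 = λ row≤r r<y1-1 → ℤ.<⇒≤ (winding-left<0 (ℤ.≤-trans (ℤ.<⇒≤ T.yb<row) row≤r)
                                                             (ℤ.<-trans r<y1-1 (pred[i]<i y1))) }

    q↛down-p : (q , left q) ∈ s → (q , down p) ∉ s
    q↛down-p qL h = pred[pred[i]]≢i (sym (cong proj₁ (outUniq h qL)))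

    crossFlip-then-shortcut : (q , left q) ∈ s → (down q , q) ∈ s → y0 < pred (pred y1) → Progress D s
    crossFlip-then-shortcut qL dq y0<y1-2 =
      Progress-prepend (S , X.isSock , inj₁ (flipB second dq (Square-downLeft (down p)) R))
                       (μ-mono X.onSock-reflect)
                       (LocalProgress.shortcut-progress X.isSock top₁ first₁ X.ux∈t
                                                        (Square-reverse (Square-downLeft p)) qP∉s₁)
      where
      third : (down (down p) , down (down (down p))) ∈ s
      third = subst (λ z → ((c , z) , (c , pred (pred (pred y1)))) ∈ s) (ℤ.suc-pred (pred (pred y1)))
                    (run (ℤ.i<j⇒i≤pred[j] y0<y1-2)
                         (ℤ.<-trans (pred[i]<i (pred (pred y1))) (ℤ.<-trans (pred[i]<i (pred y1)) (pred[i]<i y1))))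
      removed added : List Edge
      removed = (down p , down (down p)) ∷ (down q , q) ∷ []
      added = (down p , q) ∷ (down q , down (down p)) ∷ []
      s₁ : Sock
      s₁ = replace s removed added
      R : Replace s removed added s₁
      R = replace-correct s removed added
      module X = CrossFlip S second dq (Square-downLeft (down p)) (q↛down-p qL)
                           (λ h → pred[i]≢i (cong proj₁ (outUniq h third))) R
      top₁ : (left p , p) ∈ s₁
      top₁ = X.keep top (λ e → pred[i]≢i (cong proj₁ (,-injectiveˡ e)))
                        (λ e → pred[i]≢i (sym (cong proj₁ (,-injectiveʳ e))))
      first₁ : (p , down p) ∈ s₁
      first₁ = X.keep first (λ e → i≢pred[i] (cong proj₂ (,-injectiveˡ e)))
                            (λ e → pred[i]≢i (sym (cong proj₁ (,-injectiveʳ e))))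
      qP∉s₁ : (q , left p) ∉ s₁
      qP∉s₁ h with X.origin h
      ... | X.kept h' _ _ = i≢pred[i] (cong proj₂ (outUniq h' qL))
      ... | X.new₁ e = pred[i]≢i (cong proj₁ (,-injectiveˡ e))
      ... | X.new₂ e = i≢pred[i] (cong proj₂ (,-injectiveˡ e))

    turnBack : (q , left q) ∈ s → (down q , q) ∈ s → Progress D s
    turnBack qL dq with <⇒≡pred⊎<pred y0<y1-1
    ... | inj₁ y0≡ = shortcut-progress second (subst (λ z → ((c , z) , (pred c , z)) ∈ s) y0≡ bottom) dq
                       (Square-rotate (Square-rotate (Square-rotate (Square-reverse (Square-downLeft (down p))))))
                       (q↛down-p qL)
    ... | inj₂ y0<y1-2 = crossFlip-then-shortcut qL dq y0<y1-2

    bend : ∀ {n} → Scan n → pred y1 ≤ y0 + + n → Progress D s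
    bend scan fuel with onSock? s q
    ... | no off = trit-corner off
    ... | yes on with exit on | entry on
    ...   | toUp qP | _ = shortcut-corner qP
    ...   | toLeft qL | fromLeft Lq = ⊥-elim (noBack qL Lq)
    ...   | toDown qd | fromDown dq = ⊥-elim (noBack qd dq)
    ...   | toDown qd | fromLeft Lq = nested scan fuel Lq qd
    ...   | toLeft qL | fromDown dq = turnBack qL dq

  scan : ∀ n → Scan n
  scan zero fuel B = ⊥-elim (ℤ.<⇒≱ (Bracket.y0<y1 B) (subst (_ ≤_) (ℤ.+-identityʳ _) fuel))
  scan (suc n) {c} {y0} {y1} fuel B with <⇒≡pred⊎<pred (Bracket.y0<y1 B)
  ... | inj₁ refl = closeBracket B
  ... | inj₂ y0<y1-1 = Corner.bend B y0<y1-1 (scan n) (≤-pred-fuel {b = y0} {k = n} fuel)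

lexicographic : TotalOrder _ _ _
lexicographic = ×-totalOrder ℤ.≤-decTotalOrder ℤ.≤-totalOrder

_≤ₗₑₓ_ : V → V → Set
_≤ₗₑₓ_ = TotalOrder._≤_ lexicographic

private
  module Lex = Data.List.Extrema lexicographic

IsTopRight : Sock → V → Set
IsTopRight s v = ∀ {z} → OnSock s z → z ≤ₗₑₓ v

topRight : ∀ {D e es} → IsSock D (e ∷ es) → ∃ λ v → OnSock (e ∷ es) v × IsTopRight (e ∷ es) v
topRight {e = e} {es} S = v , on , bound
  where
  open SockProperties S
  v : V
  v = Lex.max (proj₁ e) (map proj₁ es)
  on : OnSock (e ∷ es) v
  on with Lex.argmax-sel (λ x → x) (proj₁ e) (map proj₁ es)
  ... | inj₁ v≡ = proj₂ e , inj₁ (subst (λ a → (a , proj₂ e) ∈ e ∷ es) (sym v≡) (here refl))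
  ... | inj₂ v∈ with ∈-map⁻ proj₁ v∈
  ...   | (a , b) , ab∈ , refl = b , inj₁ (there ab∈)
  bound : IsTopRight (e ∷ es) v
  bound on-z with outEdge on-z
  ... | w , here refl = Lex.⊥≤max (proj₁ e) (map proj₁ es)
  ... | w , there zw∈ = All.lookup (Lex.xs≤max (proj₁ e) (map proj₁ es)) (∈-map⁺ proj₁ zw∈)

module Start {D : Region} (cc : ComplementConnected D) {s : Sock} (S : IsSock D s) where
  open IsSock S
  open SockProperties S
  open Winding S
  open Descent cc S

  module _ {c y1} (max : IsTopRight s (c , y1)) where

    ¬OnSock-right : ∀ {y} → ¬ OnSock s (sucℤ c , y)
    ¬OnSock-right on with max on
    ... | inj₁ (c+1≤c , _) = ℤ.<⇒≱ (i<suc[i] c) c+1≤c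
    ... | inj₂ (c+1≡c , _) = ℤ.i≢suc[i] (sym c+1≡c)

    ¬OnSock-up : ¬ OnSock s (c , sucℤ y1)
    ¬OnSock-up on with max on
    ... | inj₁ (_ , c≢c) = c≢c refl
    ... | inj₂ (_ , y1+1≤y1) = ℤ.<⇒≱ (i<suc[i] y1) y1+1≤y1

    source≤c : ∀ {a b} → (a , b) ∈ s → proj₁ a ≤ c
    source≤c ab with max (_ , inj₁ ab)
    ... | inj₁ (a≤c , _) = a≤c
    ... | inj₂ (a≡c , _) = ℤ.≤-reflexive a≡c

    -- Below the lowest row of D the run down column c must have turned.
    bracket : ((pred c , y1) , (c , y1)) ∈ s → ((c , y1) , (c , pred y1)) ∈ s → ∃ λ y0 → Bracket c y0 y1
    bracket top first = T.row , record
      { y0<y1 = T.row<top ; top = top ; run = T.run ; bottom = T.turn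
      ; winding≤0 = λ _ _ → ℤ.≤-reflexive (winding-beyond c _ source≤c) }
      where
      yb : ℤ
      yb = pred (ℤExtrema.min y1 (map proj₂ D))
      yb<D : ∀ {d} → d ∈ D → yb < proj₂ d
      yb<D d∈D =
        ℤ.<-≤-trans (pred[i]<i _) (All.lookup (ℤExtrema.min≤xs y1 (map proj₂ D)) (∈-map⁺ proj₂ d∈D))
      yb<y1-1 : yb < pred y1
      yb<y1-1 = yb<D (target∈D first)
      T : LeftTurn c yb y1
      T = descend _ (≤-initial-fuel (ℤ.<⇒≤ yb<y1-1)) yb<y1-1 (pred[i]<i y1) (Run-extend Run-empty first)
                  (λ _ _ h → ¬OnSock-right (_ , inj₂ h)) (λ h → ℤ.<-irrefl refl (yb<D (target∈D h)))
      module T = LeftTurn T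

    progress-at : ((pred c , y1) , (c , y1)) ∈ s → ((c , y1) , (c , pred y1)) ∈ s → Progress D s
    progress-at top first with bracket top first
    ... | y0 , B = scan _ (≤-initial-fuel (ℤ.<⇒≤ (Bracket.y0<y1 B))) B

    data Passage : Set where
      leftThenDown : (left (c , y1) , (c , y1)) ∈ s → ((c , y1) , down (c , y1)) ∈ s → Passage
      downThenLeft : (down (c , y1) , (c , y1)) ∈ s → ((c , y1) , left (c , y1)) ∈ s → Passage

    passage : OnSock s (c , y1) → Passage
    passage on = classify (outEdge on) (inEdge on)
      where
      v : V
      v = (c , y1)
      classify : (∃ λ w → (v , w) ∈ s) → (∃ λ w → (w , v) ∈ s) → Passage
      classify (w , vw) (u , uv)
        with Adj⇒Neighbour {v} {w} (edge-Adj vw) | Adj⇒Neighbour {v} {u} (Adj-sym u v (edge-Adj uv))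
      ... | isRight refl | _ = ⊥-elim (¬OnSock-right (_ , inj₂ vw))
      ... | isUp refl | _ = ⊥-elim (¬OnSock-up (_ , inj₂ vw))
      ... | _ | isRight refl = ⊥-elim (¬OnSock-right (_ , inj₁ uv))
      ... | _ | isUp refl = ⊥-elim (¬OnSock-up (_ , inj₁ uv))
      ... | isLeft refl | isLeft refl = ⊥-elim (noBack vw uv)
      ... | isDown refl | isDown refl = ⊥-elim (noBack vw uv)
      ... | isDown refl | isLeft refl = leftThenDown uv vw
      ... | isLeft refl | isDown refl = downThenLeft uv vw

progress : ∀ {D} → ComplementConnected D → ∀ {e es} → IsSock D (e ∷ es) → Progress D (e ∷ es)
progress cc S with topRight S
... | (c , y1) , on , max with Start.passage cc S max on
...   | Start.leftThenDown top first = Start.progress-at cc S max top first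
...   | Start.downThenLeft bottom last = Progress-reverse
  (Start.progress-at cc (IsSock-reverse S) (λ on → max (OnSock-reverse⁻ on))
                     (∈-reverseEdges⁺ last) (∈-reverseEdges⁺ bottom))

toEmpty : ∀ {D} → ComplementConnected D → ∀ n {s} → IsSock D s → Measure.μ D s ℕ.< n →
          FlipTritHomotopic D s []
toEmpty cc zero _ ()
toEmpty cc (suc n) {[]} _ _ = ε
toEmpty cc (suc n) {e ∷ es} S μ<n with progress cc S
... | t , s↝t , T , t<s = s↝t ◅◅ toEmpty cc n T (ℕ.<-≤-trans t<s (ℕ.s≤s⁻¹ μ<n))

lemma8p2 : (D : Region) → SimplyConnected D →
    (s : Sock) → IsSock D s → FlipTritHomotopic D s []
lemma8p2 D (_ , cc) s S = toEmpty cc (suc (Measure.μ D s)) S (ℕ.n<1+n _)
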